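{- Let $m\ge1$ and $k\ge1$ be integers. For every $i\in\{1,\dots,k\}$, $$\sum_{\pi\in\mathcal P_{m}^{k+1}} q^{\mathrm{mak}(\pi)+k-\mathrm{nrinv}(g(B_{i+1}),\pi)}=q^{i}\sum_{\pi\in\mathcal P_{m}^{k+1}}q^{\mathrm{mak}(\pi)}.$$
   Context: $\mathcal P_m^{k+1}$ denotes the set of set partitions of $[m]$ into $k+1$ blocks, written $\pi=B_1-\cdots-B_{k+1}$ with the blocks listed in increasing order of their smallest elements. Let $w_a$ be the index of the block containing $a$. The openers $\mathcal O(\pi)$ are the smallest elements of the blocks, and the closers $\mathcal F(\pi)$ are their largest elements. Define $\mathrm{mak}(\pi)=\sum_{i}\#\{j\in\mathcal O(\pi): j<i,\ w_j>w_i\}+\sum_i\#\{j\in\mathcal F(\pi): j<i,\ w_j<w_i\}$. Let $\mathrm{nrinv}(b,\pi)=\#\{a: w_a>w_b,\ a>b\}$, and let $g(B_j)$ be the largest element of $B_j$. -}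

module Defs where

open import Data.Nat using (ℕ; zero; suc; _+_; _<ᵇ_; _≡ᵇ_)
open import Data.Bool using (Bool; true; false; if_then_else_; _∧_; not)
open import Data.List using (List; []; _∷_; map; concatMap; upTo; foldl; filter; length)
open import Data.Nat.ListAction using (sum)
open import Data.Bool.ListAction using (and)
open import Data.Maybe using (Maybe; just; nothing)
open import Data.Integer as ℤ using (ℤ; +_; _-_)

-- A set partition π = B₁-⋯-B_{k+1} of [m] (blocks ordered by
-- increasing minima) is encoded by its restricted growth word
-- w = w₀ w₁ ⋯ w_{m-1} : List ℕ, where position a (0-based) stands for the
-- element a+1 of [m] and w_a (0-based) is the index of its block minus 1.
-- Order on elements and on block indices is preserved by this shift.

at : List ℕ → ℕ → ℕ
at []       _       = 0
at (x ∷ _)  zero    = x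
at (_ ∷ xs) (suc a) = at xs a

words : ℕ → ℕ → List (List ℕ)
words zero    n = [] ∷ []
words (suc m) n = concatMap (λ x → map (x ∷_) (words m n)) (upTo n)

-- number of blocks of a restricted growth word (nothing if not RGF);
-- the second argument is the number of blocks opened so far
rgfBlocks : List ℕ → ℕ → Maybe ℕ
rgfBlocks []       nb = just nb
rgfBlocks (x ∷ xs) nb =
  if x <ᵇ nb then rgfBlocks xs nb
  else if x ≡ᵇ nb then rgfBlocks xs (suc nb)
  else nothing

hasBlocks : ℕ → List ℕ → Bool
hasBlocks b w with rgfBlocks w 0
... | just nb = nb ≡ᵇ b
... | nothing = false

-- 𝒫_m^{k+1}: all set partitions of [m] into k+1 blocks (as RGF words)
partitions : ℕ → ℕ → List (List ℕ)
partitions m k = filter (λ w → Data.Bool._≟_ (hasBlocks (suc k) w) true) (words m (suc k))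
  where import Data.Bool

count : (ℕ → Bool) → ℕ → ℕ
count p n = sum (map (λ j → if p j then 1 else 0) (upTo n))

allBelow : (ℕ → Bool) → ℕ → Bool
allBelow p n = and (map p (upTo n))

isOpener : ℕ → List ℕ → ℕ → Bool
isOpener m w j = allBelow (λ b → not (b <ᵇ j) ∨' not (at w b ≡ᵇ at w j)) m
  where
  _∨'_ : Bool → Bool → Bool
  true  ∨' _ = true
  false ∨' b = b

isCloser : ℕ → List ℕ → ℕ → Bool
isCloser m w j = allBelow (λ b → not (j <ᵇ b) ∨' not (at w b ≡ᵇ at w j)) m
  where
  _∨'_ : Bool → Bool → Bool
  true  ∨' _ = true
  false ∨' b = b

mak : ℕ → List ℕ → ℕ
mak m w =
  sum (map (λ i → count (λ j → (j <ᵇ i) ∧ isOpener m w j ∧ (at w i <ᵇ at w j)) m) (upTo m))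
  + sum (map (λ i → count (λ j → (j <ᵇ i) ∧ isCloser m w j ∧ (at w j <ᵇ at w i)) m) (upTo m))

nrinv : ℕ → List ℕ → ℕ → ℕ
nrinv m w b = count (λ a → (b <ᵇ a) ∧ (at w b <ᵇ at w a)) m

g : ℕ → List ℕ → ℕ → ℕ
g m w c = foldl (λ acc a → if at w a ≡ᵇ c then a else acc) 0 (upTo m)

-- exponent  mak(π) + k − nrinv(g(B_{i+1}), π)  (an integer);
-- the paper's block B_{i+1} has 0-based index i
lhsExp : ℕ → ℕ → ℕ → List ℕ → ℤ
lhsExp m k i w = + (mak m w + k) - + nrinv m w (g m w i)

rhsExp : ℕ → ℕ → List ℕ → ℤ
rhsExp m i w = + (mak m w + i)

-- number of partitions in 𝒫_m^{k+1} whose exponent under e equals n,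
-- i.e. the coefficient of q^n in Σ_{π ∈ 𝒫_m^{k+1}} q^{e(π)}
coeff : ℕ → ℕ → (List ℕ → ℤ) → ℤ → ℕ
coeff m k e n = length (filter (λ w → e w ℤ.≟ n) (partitions m k))

-- Grow a partition by appending its largest element, i.e. its restricted growth word w by
-- one letter x, and let w x have k + 1 blocks.  Appending a letter of an existing block x
-- raises mak by k − nrinv(g(x)), opening the new block x = k raises it by k, and for every
-- block c ≠ x, nrinv(g(c)) grows by one iff c < x, while g(x) becomes the last position.
-- Hence, for a set S of marked blocks and mak_S = mak − Σ_{c ∈ S} nrinv(g(c)),
--   mak_S(w x) = mak_{S ∪ {x}}(w) + k − #{c ∈ S : c < x}   (x an existing block),
--   mak_S(w k) = mak_S(w) + k − #{c ∈ S : c < k}            (x = k a new block).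
-- By induction on the length, mak_S is distributed over partitions into b blocks like
-- mak − Σ_{c ∈ S} (b − 1 − c): after the induction hypothesis the shifts of the letters
-- x = 0, …, k run through a permutation of {0, …, k} (shuffle), so the recurrence obtained
-- does not depend on S.  For S = {i} and b = k + 1 this is the theorem.

module Submission where

open import Defs
open import Data.Nat using (ℕ; _≤_)
open import Data.Integer using (ℤ)
open import Relation.Binary.PropositionalEquality using (_≡_)

import Algebra.Properties.CommutativeSemigroup
open import Data.Bool using (Bool; true; false; not; _∧_; _∨_; if_then_else_)
import Data.Bool as Bool
open import Data.Bool.ListAction using (and)
open import Data.Bool.Properties using (∧-assoc; ∧-identityʳ; ∧-zeroʳ; ∨-identityʳ; ∨-zeroʳ; T-≡)
open import Data.Empty using (⊥-elim)
open import Data.Integer as ℤ using (+_)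
import Data.Integer.Properties as ℤ
open import Data.Integer.Tactic.RingSolver using () renaming (solve-∀ to ℤ-solve-∀)
open import Data.List using (List; []; _∷_; _++_; _∷ʳ_; map; concatMap; filter; length; upTo; foldl; [_])
open import Data.List.Properties using (upTo-∷ʳ; map-++; foldl-++; length-++)
open import Data.List.Reverse using (Reverse; reverseView; []; _∶_∶ʳ_)
open import Data.Maybe using (Maybe; just; nothing; maybe′; _>>=_)
open import Data.Maybe.Properties using (just-injective)
open import Data.Nat using (zero; suc; _+_; _*_; _∸_; _<_; s≤s; _≡ᵇ_; _<ᵇ_)
open import Data.Nat.ListAction using (sum)
open import Data.Nat.ListAction.Properties using (sum-++)
open import Data.Nat.Properties
open import Data.Nat.Tactic.RingSolver using (solve-∀)
open import Data.Product using (∃; _×_; _,_)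
open import Data.Sum using (_⊎_; inj₁; inj₂)
open import Function using (_∘_; Equivalence)
open import Level using (0ℓ)
open import Relation.Binary.Definitions using (tri<; tri≈; tri>)
open import Relation.Binary.PropositionalEquality hiding ([_])
open import Relation.Nullary using (does; yes; no)
open import Relation.Nullary.Decidable using (dec-true; dec-false)
open import Relation.Unary using (Pred; Decidable)

open Algebra.Properties.CommutativeSemigroup +-commutativeSemigroup using ()
  renaming (interchange to +-interchange; xy∙z≈xz∙y to +-right-comm)

≡ᵇ-refl : ∀ n → (n ≡ᵇ n) ≡ true
≡ᵇ-refl n = dec-true (n ≟ n) refl

≢⇒≡ᵇ-false : ∀ {m n} → m ≢ n → (m ≡ᵇ n) ≡ false
≢⇒≡ᵇ-false {m} {n} = dec-false (m ≟ n)

≡ᵇ-true⇒≡ : ∀ {m n} → (m ≡ᵇ n) ≡ true → m ≡ n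
≡ᵇ-true⇒≡ {m} {n} e = ≡ᵇ⇒≡ m n (Equivalence.from T-≡ e)

≡ᵇ-sym : ∀ m n → (m ≡ᵇ n) ≡ (n ≡ᵇ m)
≡ᵇ-sym zero    zero    = refl
≡ᵇ-sym zero    (suc n) = refl
≡ᵇ-sym (suc m) zero    = refl
≡ᵇ-sym (suc m) (suc n) = ≡ᵇ-sym m n

<⇒<ᵇ-true : ∀ {m n} → m < n → (m <ᵇ n) ≡ true
<⇒<ᵇ-true {m} {n} = dec-true (m <? n)

≥⇒<ᵇ-false : ∀ {m n} → n ≤ m → (m <ᵇ n) ≡ false
≥⇒<ᵇ-false {m} {n} n≤m = dec-false (m <? n) (≤⇒≯ n≤m)

<ᵇ-true⇒< : ∀ {m n} → (m <ᵇ n) ≡ true → m < n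
<ᵇ-true⇒< {m} {n} e = <ᵇ⇒< m n (Equivalence.from T-≡ e)

<-suc-cases : ∀ {c n} → c < suc n → c < n ⊎ c ≡ n
<-suc-cases c<1+n = m≤n⇒m<n∨m≡n (≤-pred c<1+n)

⟦_⟧ : Bool → ℕ
⟦ b ⟧ = if b then 1 else 0

⟦∧⟧ : ∀ a c → ⟦ a ∧ c ⟧ ≡ ⟦ a ⟧ * ⟦ c ⟧
⟦∧⟧ true  c = sym (+-identityʳ _)
⟦∧⟧ false c = refl

⟦⟧*-cong : ∀ β {a c} → (β ≡ true → a ≡ c) → ⟦ β ⟧ * a ≡ ⟦ β ⟧ * c
⟦⟧*-cong true  h = cong (_+ 0) (h refl)
⟦⟧*-cong false h = refl

Σ< : ℕ → (ℕ → ℕ) → ℕ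
Σ< zero    f = 0
Σ< (suc n) f = Σ< n f + f n

rank : (ℕ → Bool) → ℕ → ℕ
rank S x = Σ< x (λ c → ⟦ S c ⟧)

Σ∈ : {A : Set} → List A → (A → ℕ) → ℕ
Σ∈ []       f = 0
Σ∈ (x ∷ xs) f = f x + Σ∈ xs f

Σ<-cong : ∀ n {f h : ℕ → ℕ} → (∀ c → c < n → f c ≡ h c) → Σ< n f ≡ Σ< n h
Σ<-cong zero    e = refl
Σ<-cong (suc n) e = cong₂ _+_ (Σ<-cong n (λ c c<n → e c (m<n⇒m<1+n c<n))) (e n ≤-refl)

Σ<-0 : ∀ n {f : ℕ → ℕ} → (∀ c → c < n → f c ≡ 0) → Σ< n f ≡ 0
Σ<-0 zero    e = refl
Σ<-0 (suc n) e = cong₂ _+_ (Σ<-0 n (λ c c<n → e c (m<n⇒m<1+n c<n))) (e n ≤-refl)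

Σ<-1 : ∀ n → Σ< n (λ _ → 1) ≡ n
Σ<-1 zero    = refl
Σ<-1 (suc n) = trans (cong (_+ 1) (Σ<-1 n)) (+-comm n 1)

Σ<-distrib-+ : ∀ n (f h : ℕ → ℕ) → Σ< n (λ c → f c + h c) ≡ Σ< n f + Σ< n h
Σ<-distrib-+ zero    f h = refl
Σ<-distrib-+ (suc n) f h =
  trans (cong (_+ (f n + h n)) (Σ<-distrib-+ n f h)) (+-interchange (Σ< n f) (Σ< n h) (f n) (h n))

*-distribˡ-Σ< : ∀ n a (f : ℕ → ℕ) → Σ< n (λ c → a * f c) ≡ a * Σ< n f
*-distribˡ-Σ< zero    a f = sym (*-zeroʳ a)
*-distribˡ-Σ< (suc n) a f = trans (cong (_+ a * f n) (*-distribˡ-Σ< n a f)) (sym (*-distribˡ-+ a (Σ< n f) (f n)))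

Σ<-suc-front : ∀ n (f : ℕ → ℕ) → Σ< (suc n) f ≡ f 0 + Σ< n (f ∘ suc)
Σ<-suc-front zero    f = +-comm 0 (f 0)
Σ<-suc-front (suc n) f = trans (cong (_+ f (suc n)) (Σ<-suc-front n f)) (+-assoc (f 0) _ _)

Σ<-≡ᵇ-out : ∀ n x (f : ℕ → ℕ) → n ≤ x → Σ< n (λ c → ⟦ c ≡ᵇ x ⟧ * f c) ≡ 0
Σ<-≡ᵇ-out n x f n≤x =
  Σ<-0 n (λ c c<n → cong (λ t → ⟦ t ⟧ * f c) (≢⇒≡ᵇ-false (<⇒≢ (<-≤-trans c<n n≤x))))

Σ<-≡ᵇ : ∀ n x (f : ℕ → ℕ) → x < n → Σ< n (λ c → ⟦ c ≡ᵇ x ⟧ * f c) ≡ f x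
Σ<-≡ᵇ (suc n) x f x<1+n with <-suc-cases x<1+n
... | inj₁ x<n = trans (cong₂ _+_ (Σ<-≡ᵇ n x f x<n) (cong (λ t → ⟦ t ⟧ * f n) (≢⇒≡ᵇ-false (>⇒≢ x<n))))
                       (+-identityʳ (f x))
... | inj₂ refl = cong₂ _+_ (Σ<-≡ᵇ-out n n f ≤-refl)
                            (trans (cong (λ t → ⟦ t ⟧ * f n) (≡ᵇ-refl n)) (+-identityʳ (f n)))

Σ<-extract : ∀ n x (f : ℕ → ℕ) → x < n → Σ< n f ≡ Σ< n (λ c → ⟦ not (c ≡ᵇ x) ⟧ * f c) + f x
Σ<-extract n x f x<n = begin
  Σ< n f                                          ≡⟨ Σ<-cong n (λ c _ → split (c ≡ᵇ x) (f c)) ⟩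
  Σ< n (λ c → ⟦ not (c ≡ᵇ x) ⟧ * f c + ⟦ c ≡ᵇ x ⟧ * f c) ≡⟨ Σ<-distrib-+ n _ _ ⟩
  others + Σ< n (λ c → ⟦ c ≡ᵇ x ⟧ * f c)          ≡⟨ cong (_+_ others) (Σ<-≡ᵇ n x f x<n) ⟩
  others + f x                                    ∎
  where
  open ≡-Reasoning
  others : ℕ
  others = Σ< n (λ c → ⟦ not (c ≡ᵇ x) ⟧ * f c)
  split : ∀ e a → a ≡ ⟦ not e ⟧ * a + ⟦ e ⟧ * a
  split true  a = sym (+-identityʳ a)
  split false a = sym (trans (+-identityʳ _) (+-identityʳ a))

Σ<-<ᵇ : ∀ n b (f : ℕ → ℕ) → b ≤ n → Σ< n (λ c → ⟦ c <ᵇ b ⟧ * f c) ≡ Σ< b f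
Σ<-<ᵇ zero    zero f _ = refl
Σ<-<ᵇ (suc n) b f b≤1+n with m≤n⇒m<n∨m≡n b≤1+n
... | inj₁ b<1+n = trans (cong₂ _+_ (Σ<-<ᵇ n b f (≤-pred b<1+n))
                                    (cong (λ t → ⟦ t ⟧ * f n) (≥⇒<ᵇ-false (≤-pred b<1+n))))
                         (+-identityʳ _)
... | inj₂ refl = Σ<-cong (suc n) (λ c c<b → trans (cong (λ t → ⟦ t ⟧ * f c) (<⇒<ᵇ-true c<b)) (+-identityʳ (f c)))

Σ<-rank : ∀ (S : ℕ → Bool) n (f : ℕ → ℕ) → Σ< n (λ x → ⟦ S x ⟧ * f (rank S x)) ≡ Σ< (rank S n) f
Σ<-rank S zero    f = refl
Σ<-rank S (suc n) f with S n
... | true  = trans (cong₂ _+_ (Σ<-rank S n f) (+-identityʳ _)) (cong (λ r → Σ< r f) (+-comm 1 (rank S n)))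
... | false = trans (+-identityʳ _) (trans (Σ<-rank S n f) (cong (λ r → Σ< r f) (sym (+-identityʳ (rank S n)))))

rank+rank-not : ∀ (S : ℕ → Bool) x → rank S x + rank (not ∘ S) x ≡ x
rank+rank-not S x =
  trans (sym (Σ<-distrib-+ x _ _)) (trans (Σ<-cong x (λ c _ → one (S c))) (Σ<-1 x))
  where
  one : ∀ s → ⟦ s ⟧ + ⟦ not s ⟧ ≡ 1
  one true  = refl
  one false = refl

rank≤ : ∀ (S : ℕ → Bool) x → rank S x ≤ x
rank≤ S x = subst (rank S x ≤_) (rank+rank-not S x) (m≤m+n (rank S x) _)

Σ<-reverse-++ : ∀ s t (f : ℕ → ℕ) → Σ< s (λ j → f (t + s ∸ suc j)) + Σ< t f ≡ Σ< (t + s) f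
Σ<-reverse-++ zero    t f = cong (λ n → Σ< n f) (sym (+-identityʳ t))
Σ<-reverse-++ (suc s) t f = begin
  Σ< (suc s) (λ j → f (t + suc s ∸ suc j)) + Σ< t f
    ≡⟨ cong (λ n → Σ< (suc s) (λ j → f (n ∸ suc j)) + Σ< t f) (+-suc t s) ⟩
  Σ< (suc s) (λ j → f (suc (t + s) ∸ suc j)) + Σ< t f
    ≡⟨ cong (_+ Σ< t f) (Σ<-suc-front s _) ⟩
  f (t + s) + Σ< s (λ j → f (t + s ∸ suc j)) + Σ< t f
    ≡⟨ +-assoc (f (t + s)) _ _ ⟩
  f (t + s) + (Σ< s (λ j → f (t + s ∸ suc j)) + Σ< t f)
    ≡⟨ cong (_+_ (f (t + s))) (Σ<-reverse-++ s t f) ⟩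
  f (t + s) + Σ< (t + s) f
    ≡⟨ +-comm (f (t + s)) _ ⟩
  Σ< (suc (t + s)) f
    ≡⟨ cong (λ n → Σ< n f) (sym (+-suc t s)) ⟩
  Σ< (t + suc s) f ∎
  where open ≡-Reasoning

-- A permutation of {0, …, b − 1}: the unmarked x go, in increasing order, to 0, 1, …, and the
-- marked x, in increasing order, to b − 1, b − 2, ….
shuffle : ℕ → (ℕ → Bool) → ℕ → ℕ
shuffle b S x = if S x then b ∸ suc (rank S x) else x ∸ rank S x

Σ<-shuffle : ∀ b (S : ℕ → Bool) (f : ℕ → ℕ) → Σ< b (f ∘ shuffle b S) ≡ Σ< b f
Σ<-shuffle b S f = begin
  Σ< b (f ∘ shuffle b S)
    ≡⟨ Σ<-cong b (λ x _ → by-mark x) ⟩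
  Σ< b (λ x → ⟦ S x ⟧ * f (b ∸ suc (rank S x)) + ⟦ not (S x) ⟧ * f (rank S′ x))
    ≡⟨ Σ<-distrib-+ b _ _ ⟩
  Σ< b (λ x → ⟦ S x ⟧ * f (b ∸ suc (rank S x))) + Σ< b (λ x → ⟦ S′ x ⟧ * f (rank S′ x))
    ≡⟨ cong₂ _+_ (Σ<-rank S b (λ j → f (b ∸ suc j))) (Σ<-rank S′ b f) ⟩
  Σ< (rank S b) (λ j → f (b ∸ suc j)) + Σ< (rank S′ b) f
    ≡⟨ cong (λ n → Σ< (rank S b) (λ j → f (n ∸ suc j)) + Σ< (rank S′ b) f) (sym ranks) ⟩
  Σ< (rank S b) (λ j → f (rank S′ b + rank S b ∸ suc j)) + Σ< (rank S′ b) f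
    ≡⟨ Σ<-reverse-++ (rank S b) (rank S′ b) f ⟩
  Σ< (rank S′ b + rank S b) f
    ≡⟨ cong (λ n → Σ< n f) ranks ⟩
  Σ< b f ∎
  where
  open ≡-Reasoning
  S′ : ℕ → Bool
  S′ = not ∘ S
  ranks : rank S′ b + rank S b ≡ b
  ranks = trans (+-comm (rank S′ b) (rank S b)) (rank+rank-not S b)
  by-mark : ∀ x → f (shuffle b S x) ≡ ⟦ S x ⟧ * f (b ∸ suc (rank S x)) + ⟦ not (S x) ⟧ * f (rank S′ x)
  by-mark x with S x
  ... | true  = sym (trans (+-identityʳ _) (+-identityʳ _))
  ... | false = trans (cong f (trans (cong (_∸ rank S x) (sym (rank+rank-not S x))) (m+n∸m≡n (rank S x) (rank S′ x))))
                      (sym (+-identityʳ _))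

Σ∈-cong : {A : Set} (L : List A) {f h : A → ℕ} → (∀ x → f x ≡ h x) → Σ∈ L f ≡ Σ∈ L h
Σ∈-cong []      e = refl
Σ∈-cong (x ∷ L) e = cong₂ _+_ (e x) (Σ∈-cong L e)

Σ∈-0 : {A : Set} (L : List A) {f : A → ℕ} → (∀ x → f x ≡ 0) → Σ∈ L f ≡ 0
Σ∈-0 []      e = refl
Σ∈-0 (x ∷ L) e = cong₂ _+_ (e x) (Σ∈-0 L e)

Σ∈-++ : {A : Set} (L M : List A) (f : A → ℕ) → Σ∈ (L ++ M) f ≡ Σ∈ L f + Σ∈ M f
Σ∈-++ []      M f = refl
Σ∈-++ (x ∷ L) M f = trans (cong (_+_ (f x)) (Σ∈-++ L M f)) (sym (+-assoc (f x) _ _))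

Σ∈-distrib-+ : {A : Set} (L : List A) (f h : A → ℕ) → Σ∈ L (λ x → f x + h x) ≡ Σ∈ L f + Σ∈ L h
Σ∈-distrib-+ []      f h = refl
Σ∈-distrib-+ (x ∷ L) f h =
  trans (cong (_+_ (f x + h x)) (Σ∈-distrib-+ L f h)) (+-interchange (f x) (h x) (Σ∈ L f) (Σ∈ L h))

Σ∈-map : {A B : Set} (L : List A) (φ : A → B) (f : B → ℕ) → Σ∈ (map φ L) f ≡ Σ∈ L (f ∘ φ)
Σ∈-map []      φ f = refl
Σ∈-map (x ∷ L) φ f = cong (_+_ (f (φ x))) (Σ∈-map L φ f)

Σ∈-concatMap : {A B : Set} (L : List A) (φ : A → List B) (f : B → ℕ) →
               Σ∈ (concatMap φ L) f ≡ Σ∈ L (λ x → Σ∈ (φ x) f)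
Σ∈-concatMap []      φ f = refl
Σ∈-concatMap (x ∷ L) φ f = trans (Σ∈-++ (φ x) (concatMap φ L) f) (cong (_+_ (Σ∈ (φ x) f)) (Σ∈-concatMap L φ f))

Σ∈-filter : {A : Set} {P : Pred A 0ℓ} (P? : Decidable P) (L : List A) (f : A → ℕ) →
            Σ∈ (filter P? L) f ≡ Σ∈ L (λ x → ⟦ does (P? x) ⟧ * f x)
Σ∈-filter P? []      f = refl
Σ∈-filter P? (x ∷ L) f with does (P? x)
... | true  = cong₂ _+_ (sym (+-identityʳ (f x))) (Σ∈-filter P? L f)
... | false = Σ∈-filter P? L f

length≡Σ∈1 : {A : Set} (L : List A) → length L ≡ Σ∈ L (λ _ → 1)
length≡Σ∈1 []      = refl
length≡Σ∈1 (x ∷ L) = cong suc (length≡Σ∈1 L)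

Σ∈-Σ<-comm : {A : Set} (L : List A) (n : ℕ) (f : A → ℕ → ℕ) →
             Σ∈ L (λ x → Σ< n (f x)) ≡ Σ< n (λ c → Σ∈ L (λ x → f x c))
Σ∈-Σ<-comm L zero    f = Σ∈-0 L (λ _ → refl)
Σ∈-Σ<-comm L (suc n) f = trans (Σ∈-distrib-+ L _ _) (cong (_+ Σ∈ L (λ x → f x n)) (Σ∈-Σ<-comm L n f))

map-upTo-suc : {A : Set} (f : ℕ → A) (n : ℕ) → map f (upTo (suc n)) ≡ map f (upTo n) ++ [ f n ]
map-upTo-suc f n = trans (cong (map f) (sym (upTo-∷ʳ n))) (map-++ f (upTo n) [ n ])

sum-map-upTo : ∀ n (f : ℕ → ℕ) → sum (map f (upTo n)) ≡ Σ< n f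
sum-map-upTo zero    f = refl
sum-map-upTo (suc n) f = begin
  sum (map f (upTo (suc n)))       ≡⟨ cong sum (map-upTo-suc f n) ⟩
  sum (map f (upTo n) ++ [ f n ])  ≡⟨ sum-++ (map f (upTo n)) [ f n ] ⟩
  sum (map f (upTo n)) + (f n + 0) ≡⟨ cong₂ _+_ (sum-map-upTo n f) (+-identityʳ (f n)) ⟩
  Σ< n f + f n                     ∎
  where open ≡-Reasoning

Σ∈-upTo : ∀ n (f : ℕ → ℕ) → Σ∈ (upTo n) f ≡ Σ< n f
Σ∈-upTo n f = trans (Σ∈≡sum-map (upTo n)) (sum-map-upTo n f)
  where
  Σ∈≡sum-map : (L : List ℕ) → Σ∈ L f ≡ sum (map f L)
  Σ∈≡sum-map []      = refl
  Σ∈≡sum-map (x ∷ L) = cong (_+_ (f x)) (Σ∈≡sum-map L)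

Σ∈-words-suc : ∀ m N (F : List ℕ → ℕ) → Σ∈ (words (suc m) N) F ≡ Σ< N (λ x → Σ∈ (words m N) (F ∘ (x ∷_)))
Σ∈-words-suc m N F = begin
  Σ∈ (concatMap (λ x → map (x ∷_) (words m N)) (upTo N)) F ≡⟨ Σ∈-concatMap (upTo N) _ F ⟩
  Σ∈ (upTo N) (λ x → Σ∈ (map (x ∷_) (words m N)) F)     ≡⟨ Σ∈-cong (upTo N) (λ x → Σ∈-map (words m N) (x ∷_) F) ⟩
  Σ∈ (upTo N) (λ x → Σ∈ (words m N) (F ∘ (x ∷_)))       ≡⟨ Σ∈-upTo N _ ⟩
  Σ< N (λ x → Σ∈ (words m N) (F ∘ (x ∷_)))              ∎
  where open ≡-Reasoning

Σ∈-words-∷ʳ : ∀ m N (F : List ℕ → ℕ) → Σ∈ (words (suc m) N) F ≡ Σ∈ (words m N) (λ w → Σ< N (λ x → F (w ∷ʳ x)))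
Σ∈-words-∷ʳ zero    N F =
  trans (Σ∈-words-suc zero N F) (trans (Σ<-cong N (λ x _ → +-identityʳ (F [ x ]))) (sym (+-identityʳ _)))
Σ∈-words-∷ʳ (suc m) N F = begin
  Σ∈ (words (suc (suc m)) N) F                                      ≡⟨ Σ∈-words-suc (suc m) N F ⟩
  Σ< N (λ x → Σ∈ (words (suc m) N) (F ∘ (x ∷_)))                    ≡⟨ Σ<-cong N (λ x _ → Σ∈-words-∷ʳ m N (F ∘ (x ∷_))) ⟩
  Σ< N (λ x → Σ∈ (words m N) (λ w → Σ< N (λ y → F ((x ∷ w) ∷ʳ y)))) ≡⟨ Σ∈-words-suc m N _ ⟨
  Σ∈ (words (suc m) N) (λ w → Σ< N (λ y → F (w ∷ʳ y)))              ∎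
  where open ≡-Reasoning

Σ∈-words-cong : ∀ m N {F H : List ℕ → ℕ} → (∀ w → length w ≡ m → F w ≡ H w) →
                Σ∈ (words m N) F ≡ Σ∈ (words m N) H
Σ∈-words-cong zero    N e = cong (_+ 0) (e [] refl)
Σ∈-words-cong (suc m) N e = trans (Σ∈-words-suc m N _) (trans
  (Σ<-cong N (λ x _ → Σ∈-words-cong m N (λ w len → e (x ∷ w) (cong suc len))))
  (sym (Σ∈-words-suc m N _)))

Bool-ext : ∀ {a c : Bool} → (a ≡ true → c ≡ true) → (a ≡ false → c ≡ false) → a ≡ c
Bool-ext {true}  t f = sym (t refl)
Bool-ext {false} t f = sym (f refl)

and-∷ʳ : ∀ bs b → and (bs ∷ʳ b) ≡ and bs ∧ b
and-∷ʳ []       b = ∧-identityʳ b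
and-∷ʳ (c ∷ bs) b = trans (cong (c ∧_) (and-∷ʳ bs b)) (sym (∧-assoc c (and bs) b))

allBelow-suc : ∀ (p : ℕ → Bool) n → allBelow p (suc n) ≡ allBelow p n ∧ p n
allBelow-suc p n = trans (cong and (map-upTo-suc p n)) (and-∷ʳ (map p (upTo n)) (p n))

allBelow-cong : ∀ n {p q : ℕ → Bool} → (∀ j → j < n → p j ≡ q j) → allBelow p n ≡ allBelow q n
allBelow-cong zero    e = refl
allBelow-cong (suc n) {p} {q} e = begin
  allBelow p (suc n) ≡⟨ allBelow-suc p n ⟩
  allBelow p n ∧ p n ≡⟨ cong₂ _∧_ (allBelow-cong n (λ j j<n → e j (m<n⇒m<1+n j<n))) (e n ≤-refl) ⟩
  allBelow q n ∧ q n ≡⟨ allBelow-suc q n ⟨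
  allBelow q (suc n) ∎
  where open ≡-Reasoning

allBelow-true : ∀ n {p : ℕ → Bool} → (∀ j → j < n → p j ≡ true) → allBelow p n ≡ true
allBelow-true zero    h = refl
allBelow-true (suc n) {p} h =
  trans (allBelow-suc p n) (cong₂ _∧_ (allBelow-true n (λ j j<n → h j (m<n⇒m<1+n j<n))) (h n ≤-refl))

allBelow-false : ∀ n {p : ℕ → Bool} {j} → j < n → p j ≡ false → allBelow p n ≡ false
allBelow-false (suc n) {p} j<1+n pj with <-suc-cases j<1+n
... | inj₁ j<n  = trans (allBelow-suc p n) (cong (_∧ p n) (allBelow-false n j<n pj))
... | inj₂ refl = trans (allBelow-suc p n) (trans (cong (allBelow p n ∧_) pj) (∧-zeroʳ _))

allBelow-true⇒ : ∀ n {p : ℕ → Bool} → allBelow p n ≡ true → ∀ j → j < n → p j ≡ true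
allBelow-true⇒ (suc n) {p} h j j<1+n with allBelow p n in e | p n in e′ | trans (sym (allBelow-suc p n)) h
... | true | true | _ with <-suc-cases j<1+n
...   | inj₁ j<n  = allBelow-true⇒ n e j j<n
...   | inj₂ refl = e′

allBelow-false⇒ : ∀ n {p : ℕ → Bool} → allBelow p n ≡ false → ∃ λ j → j < n × p j ≡ false
allBelow-false⇒ (suc n) {p} h with allBelow p n in e | p n in e′ | trans (sym (allBelow-suc p n)) h
... | false | _     | _ = let (j , j<n , pj) = allBelow-false⇒ n e in j , m<n⇒m<1+n j<n , pj
... | true  | false | _ = n , ≤-refl , e′

-- isOpener and isCloser use a private copy of _∨_, which is not definitionally
-- Data.Bool's _∨_ under the binder; opener? and closer? are the same predicates with _∨_.
opener? : ℕ → List ℕ → ℕ → Bool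
opener? m w j = allBelow (λ b → not (b <ᵇ j) ∨ not (at w b ≡ᵇ at w j)) m

closer? : ℕ → List ℕ → ℕ → Bool
closer? m w j = allBelow (λ b → not (j <ᵇ b) ∨ not (at w b ≡ᵇ at w j)) m

isOpener≡opener? : ∀ m w j → isOpener m w j ≡ opener? m w j
isOpener≡opener? m w j = Bool-ext (λ o → allBelow-true m (λ b b<m → earlier b b<m o)) witness
  where
  earlier : ∀ b → b < m → isOpener m w j ≡ true → not (b <ᵇ j) ∨ not (at w b ≡ᵇ at w j) ≡ true
  earlier b b<m o with b <ᵇ j | allBelow-true⇒ m o b b<m
  ... | true  | h = h
  ... | false | _ = refl
  witness : isOpener m w j ≡ false → opener? m w j ≡ false
  witness o with allBelow-false⇒ m o
  ... | b , b<m , h with b <ᵇ j in e | h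
  ...   | true  | h′ = allBelow-false m b<m (trans (cong (λ t → not t ∨ not (at w b ≡ᵇ at w j)) e) h′)
  ...   | false | ()

isCloser≡closer? : ∀ m w j → isCloser m w j ≡ closer? m w j
isCloser≡closer? m w j = Bool-ext (λ c → allBelow-true m (λ b b<m → later b b<m c)) witness
  where
  later : ∀ b → b < m → isCloser m w j ≡ true → not (j <ᵇ b) ∨ not (at w b ≡ᵇ at w j) ≡ true
  later b b<m c with j <ᵇ b | allBelow-true⇒ m c b b<m
  ... | true  | h = h
  ... | false | _ = refl
  witness : isCloser m w j ≡ false → closer? m w j ≡ false
  witness c with allBelow-false⇒ m c
  ... | b , b<m , h with j <ᵇ b in e | h
  ...   | true  | h′ = allBelow-false m b<m (trans (cong (λ t → not t ∨ not (at w b ≡ᵇ at w j)) e) h′)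
  ...   | false | ()

count≡Σ< : ∀ (p : ℕ → Bool) n → count p n ≡ Σ< n (λ j → ⟦ p j ⟧)
count≡Σ< p n = sum-map-upTo n (λ j → ⟦ p j ⟧)

lastOcc : List ℕ → ℕ → ℕ → ℕ
lastOcc w c zero    = 0
lastOcc w c (suc n) = if at w n ≡ᵇ c then n else lastOcc w c n

g≡lastOcc : ∀ m w c → g m w c ≡ lastOcc w c m
g≡lastOcc m w c = go m
  where
  step : ℕ → ℕ → ℕ
  step acc a = if at w a ≡ᵇ c then a else acc
  go : ∀ n → foldl step 0 (upTo n) ≡ lastOcc w c n
  go zero    = refl
  go (suc n) = trans (cong (foldl step 0) (sym (upTo-∷ʳ n)))
                     (trans (foldl-++ step 0 (upTo n) [ n ]) (cong (λ acc → step acc n) (go n)))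

nrinv-last : ∀ m w → nrinv (suc m) w m ≡ 0
nrinv-last m w = trans (count≡Σ< _ (suc m))
  (Σ<-0 (suc m) (λ j j<1+m → cong (λ t → ⟦ t ∧ (at w m <ᵇ at w j) ⟧) (≥⇒<ᵇ-false (≤-pred j<1+m))))

mak𝒪 makℱ : ℕ → List ℕ → ℕ
mak𝒪 m w = Σ< m (λ i → Σ< m (λ j → ⟦ (j <ᵇ i) ∧ opener? m w j ∧ (at w i <ᵇ at w j) ⟧))
makℱ m w = Σ< m (λ i → Σ< m (λ j → ⟦ (j <ᵇ i) ∧ closer? m w j ∧ (at w j <ᵇ at w i) ⟧))

mak≡mak𝒪+makℱ : ∀ m w → mak m w ≡ mak𝒪 m w + makℱ m w
mak≡mak𝒪+makℱ m w = cong₂ _+_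
  (trans (sum-map-upTo m _) (Σ<-cong m (λ i _ → trans (count≡Σ< _ m) (Σ<-cong m (λ j _ →
    cong (λ o → ⟦ (j <ᵇ i) ∧ o ∧ (at w i <ᵇ at w j) ⟧) (isOpener≡opener? m w j))))))
  (trans (sum-map-upTo m _) (Σ<-cong m (λ i _ → trans (count≡Σ< _ m) (Σ<-cong m (λ j _ →
    cong (λ c → ⟦ (j <ᵇ i) ∧ c ∧ (at w j <ᵇ at w i) ⟧) (isCloser≡closer? m w j))))))

at-∷ʳ-< : ∀ (w : List ℕ) x {j} → j < length w → at (w ∷ʳ x) j ≡ at w j
at-∷ʳ-< (y ∷ w) x {zero}  _         = refl
at-∷ʳ-< (y ∷ w) x {suc j} (s≤s j<n) = at-∷ʳ-< w x j<n

at-∷ʳ-length : ∀ (w : List ℕ) x → at (w ∷ʳ x) (length w) ≡ x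
at-∷ʳ-length []      x = refl
at-∷ʳ-length (y ∷ w) x = at-∷ʳ-length w x

lastOcc-∷ʳ : ∀ (w : List ℕ) x c n → n ≤ length w → lastOcc (w ∷ʳ x) c n ≡ lastOcc w c n
lastOcc-∷ʳ w x c zero    _   = refl
lastOcc-∷ʳ w x c (suc n) n<l =
  cong₂ (λ a l → if a ≡ᵇ c then n else l) (at-∷ʳ-< w x n<l) (lastOcc-∷ʳ w x c n (<⇒≤ n<l))

module Snoc {m : ℕ} (w : List ℕ) (x : ℕ) (len : length w ≡ m) where

  w′ : List ℕ
  w′ = w ∷ʳ x

  length-w′ : length w′ ≡ suc m
  length-w′ = trans (length-++ w) (trans (+-comm (length w) 1) (cong suc len))

  at-init : ∀ {j} → j < m → at w′ j ≡ at w j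
  at-init j<m = at-∷ʳ-< w x (subst (_ <_) (sym len) j<m)

  at-last : at w′ m ≡ x
  at-last = subst (λ n → at w′ n ≡ x) len (at-∷ʳ-length w x)

  opener?-init : ∀ {j} → j < m → opener? (suc m) w′ j ≡ opener? m w j
  opener?-init {j} j<m = trans (allBelow-suc _ m) (trans (cong₂ _∧_
    (allBelow-cong m (λ b b<m → cong₂ (λ u v → not (b <ᵇ j) ∨ not (u ≡ᵇ v)) (at-init b<m) (at-init j<m)))
    (cong (λ t → not t ∨ not (at w′ m ≡ᵇ at w′ j)) (≥⇒<ᵇ-false (<⇒≤ j<m))))
    (∧-identityʳ _))

  opener?-last : opener? (suc m) w′ m ≡ allBelow (λ b → not (at w b ≡ᵇ x)) m
  opener?-last = trans (allBelow-suc _ m) (trans (cong₂ _∧_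
    (allBelow-cong m (λ b b<m → trans (cong (λ t → not t ∨ not (at w′ b ≡ᵇ at w′ m)) (<⇒<ᵇ-true b<m))
                                      (cong₂ (λ u v → not (u ≡ᵇ v)) (at-init b<m) at-last)))
    (cong (λ t → not t ∨ not (at w′ m ≡ᵇ at w′ m)) (≥⇒<ᵇ-false {m} ≤-refl)))
    (∧-identityʳ _))

  closer?-init : ∀ {j} → j < m → closer? (suc m) w′ j ≡ closer? m w j ∧ not (at w j ≡ᵇ x)
  closer?-init {j} j<m = trans (allBelow-suc _ m) (cong₂ _∧_
    (allBelow-cong m (λ b b<m → cong₂ (λ u v → not (j <ᵇ b) ∨ not (u ≡ᵇ v)) (at-init b<m) (at-init j<m)))
    (trans (cong (λ t → not t ∨ not (at w′ m ≡ᵇ at w′ j)) (<⇒<ᵇ-true j<m))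
           (cong not (trans (cong₂ _≡ᵇ_ at-last (at-init j<m)) (≡ᵇ-sym x (at w j))))))

  closer?-last : closer? (suc m) w′ m ≡ true
  closer?-last = allBelow-true (suc m)
    (λ b b<1+m → cong (λ t → not t ∨ not (at w′ b ≡ᵇ at w′ m)) (≥⇒<ᵇ-false (≤-pred b<1+m)))

  g-∷ʳ : ∀ c → g (suc m) w′ c ≡ (if x ≡ᵇ c then m else g m w c)
  g-∷ʳ c = trans (g≡lastOcc (suc m) w′ c)
    (cong₂ (λ a l → if a ≡ᵇ c then m else l) at-last
       (trans (lastOcc-∷ʳ w x c m (≤-reflexive (sym len))) (sym (g≡lastOcc m w c))))

  nrinv-init : ∀ {a} → a < m → nrinv (suc m) w′ a ≡ nrinv m w a + ⟦ at w a <ᵇ x ⟧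
  nrinv-init {a} a<m = trans (count≡Σ< _ (suc m)) (cong₂ _+_
    (trans (Σ<-cong m (λ j j<m → cong (λ t → ⟦ (a <ᵇ j) ∧ t ⟧) (cong₂ _<ᵇ_ (at-init a<m) (at-init j<m))))
           (sym (count≡Σ< _ m)))
    (trans (cong (λ t → ⟦ t ∧ (at w′ a <ᵇ at w′ m) ⟧) (<⇒<ᵇ-true a<m))
           (cong₂ (λ u v → ⟦ u <ᵇ v ⟧) (at-init a<m) at-last)))

-- w is a restricted growth word of length m with b blocks; Σ-openers and Σ-closers say that
-- every block has exactly one opener and one closer.
record Blocks (m b : ℕ) (w : List ℕ) : Set where
  field
    length≡   : length w ≡ m
    letter<   : ∀ {j} → j < m → at w j < b
    Σ-openers : ∀ (P : ℕ → Bool) → Σ< m (λ j → ⟦ opener? m w j ∧ P (at w j) ⟧) ≡ Σ< b (λ c → ⟦ P c ⟧)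
    Σ-closers : ∀ (P : ℕ → Bool) → Σ< m (λ j → ⟦ closer? m w j ∧ P (at w j) ⟧) ≡ Σ< b (λ c → ⟦ P c ⟧)
    g<        : ∀ {c} → c < b → g m w c < m
    at-g      : ∀ {c} → c < b → at w (g m w c) ≡ c
    closer-at : ∀ {c} → c < b → ∀ {j} → j < m → (closer? m w j ∧ (at w j ≡ᵇ c)) ≡ (j ≡ᵇ g m w c)

  occurs : ∀ {c} → c < b → allBelow (λ j → not (at w j ≡ᵇ c)) m ≡ false
  occurs {c} c<b = allBelow-false m (g< c<b) (cong not (trans (cong (_≡ᵇ c) (at-g c<b)) (≡ᵇ-refl c)))

Blocks-[] : Blocks 0 0 []
Blocks-[] = record
  { length≡ = refl ; letter< = λ () ; Σ-openers = λ _ → refl ; Σ-closers = λ _ → refl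
  ; g< = λ () ; at-g = λ () ; closer-at = λ () }

module BlocksSnoc {m b w} (B : Blocks m b w) (x : ℕ) where
  open Blocks B
  open Snoc w x length≡ public

  Σ-openers-∷ʳ : ∀ (P : ℕ → Bool) → Σ< (suc m) (λ j → ⟦ opener? (suc m) w′ j ∧ P (at w′ j) ⟧)
                 ≡ Σ< b (λ c → ⟦ P c ⟧) + ⟦ allBelow (λ j → not (at w j ≡ᵇ x)) m ∧ P x ⟧
  Σ-openers-∷ʳ P = cong₂ _+_
    (trans (Σ<-cong m (λ j j<m → cong₂ (λ o a → ⟦ o ∧ P a ⟧) (opener?-init j<m) (at-init j<m))) (Σ-openers P))
    (cong₂ (λ o a → ⟦ o ∧ P a ⟧) opener?-last at-last)

  Σ-closers-∷ʳ : ∀ (P : ℕ → Bool) → Σ< (suc m) (λ j → ⟦ closer? (suc m) w′ j ∧ P (at w′ j) ⟧)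
                 ≡ Σ< b (λ c → ⟦ not (c ≡ᵇ x) ∧ P c ⟧) + ⟦ P x ⟧
  Σ-closers-∷ʳ P = cong₂ _+_
    (trans (Σ<-cong m (λ j j<m → trans (cong₂ (λ o a → ⟦ o ∧ P a ⟧) (closer?-init j<m) (at-init j<m))
                                       (cong ⟦_⟧ (∧-assoc (closer? m w j) (not (at w j ≡ᵇ x)) (P (at w j))))))
           (Σ-closers (λ c → not (c ≡ᵇ x) ∧ P c)))
    (cong₂ (λ o a → ⟦ o ∧ P a ⟧) closer?-last at-last)

  g-self : g (suc m) w′ x ≡ m
  g-self = trans (g-∷ʳ x) (cong (λ t → if t then m else g m w x) (≡ᵇ-refl x))

  g-other : ∀ {c} → x ≢ c → g (suc m) w′ c ≡ g m w c
  g-other {c} x≢c = trans (g-∷ʳ c) (cong (λ t → if t then m else g m w c) (≢⇒≡ᵇ-false x≢c))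

  g<-self : g (suc m) w′ x < suc m
  g<-self = ≤-reflexive (cong suc g-self)

  g<-other : ∀ {c} → x ≢ c → c < b → g (suc m) w′ c < suc m
  g<-other x≢c c<b = subst (_< suc m) (sym (g-other x≢c)) (m<n⇒m<1+n (g< c<b))

  at-g-self : at w′ (g (suc m) w′ x) ≡ x
  at-g-self = trans (cong (at w′) g-self) at-last

  at-g-other : ∀ {c} → x ≢ c → c < b → at w′ (g (suc m) w′ c) ≡ c
  at-g-other x≢c c<b = trans (cong (at w′) (g-other x≢c)) (trans (at-init (g< c<b)) (at-g c<b))

  closer-at-self : ∀ {j} → j < suc m → (closer? (suc m) w′ j ∧ (at w′ j ≡ᵇ x)) ≡ (j ≡ᵇ g (suc m) w′ x)
  closer-at-self {j} j<1+m with <-suc-cases j<1+m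
  ... | inj₂ refl = begin
    closer? (suc m) w′ m ∧ (at w′ m ≡ᵇ x) ≡⟨ cong₂ (λ c a → c ∧ (a ≡ᵇ x)) closer?-last at-last ⟩
    (x ≡ᵇ x)                            ≡⟨ ≡ᵇ-refl x ⟩
    true                                ≡⟨ ≡ᵇ-refl m ⟨
    (m ≡ᵇ m)                            ≡⟨ cong (m ≡ᵇ_) g-self ⟨
    (m ≡ᵇ g (suc m) w′ x)               ∎
    where open ≡-Reasoning
  ... | inj₁ j<m = begin
    closer? (suc m) w′ j ∧ (at w′ j ≡ᵇ x)                ≡⟨ cong₂ (λ c a → c ∧ (a ≡ᵇ x)) (closer?-init j<m) (at-init j<m) ⟩
    (closer? m w j ∧ not (at w j ≡ᵇ x)) ∧ (at w j ≡ᵇ x) ≡⟨ ∧-not-∧ (closer? m w j) (at w j ≡ᵇ x) ⟩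
    false                                               ≡⟨ ≢⇒≡ᵇ-false (<⇒≢ j<m) ⟨
    (j ≡ᵇ m)                                            ≡⟨ cong (j ≡ᵇ_) g-self ⟨
    (j ≡ᵇ g (suc m) w′ x)                               ∎
    where
    open ≡-Reasoning
    ∧-not-∧ : ∀ a e → (a ∧ not e) ∧ e ≡ false
    ∧-not-∧ a true  = trans (∧-identityʳ (a ∧ false)) (∧-zeroʳ a)
    ∧-not-∧ a false = ∧-zeroʳ (a ∧ true)

  closer-at-other : ∀ {c} → x ≢ c → c < b → ∀ {j} → j < suc m →
                    (closer? (suc m) w′ j ∧ (at w′ j ≡ᵇ c)) ≡ (j ≡ᵇ g (suc m) w′ c)
  closer-at-other {c} x≢c c<b {j} j<1+m with <-suc-cases j<1+m
  ... | inj₂ refl = begin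
    closer? (suc m) w′ m ∧ (at w′ m ≡ᵇ c) ≡⟨ cong₂ (λ c′ a → c′ ∧ (a ≡ᵇ c)) closer?-last at-last ⟩
    (x ≡ᵇ c)                            ≡⟨ ≢⇒≡ᵇ-false x≢c ⟩
    false                               ≡⟨ ≢⇒≡ᵇ-false (>⇒≢ (g< c<b)) ⟨
    (m ≡ᵇ g m w c)                      ≡⟨ cong (m ≡ᵇ_) (g-other x≢c) ⟨
    (m ≡ᵇ g (suc m) w′ c)               ∎
    where open ≡-Reasoning
  ... | inj₁ j<m = begin
    closer? (suc m) w′ j ∧ (at w′ j ≡ᵇ c)                ≡⟨ cong₂ (λ c′ a → c′ ∧ (a ≡ᵇ c)) (closer?-init j<m) (at-init j<m) ⟩
    (closer? m w j ∧ not (at w j ≡ᵇ x)) ∧ (at w j ≡ᵇ c) ≡⟨ drop-not (closer? m w j) (at w j ≡ᵇ x) (at w j ≡ᵇ c) exclusive ⟩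
    closer? m w j ∧ (at w j ≡ᵇ c)                       ≡⟨ closer-at c<b j<m ⟩
    (j ≡ᵇ g m w c)                                      ≡⟨ cong (j ≡ᵇ_) (g-other x≢c) ⟨
    (j ≡ᵇ g (suc m) w′ c)                               ∎
    where
    open ≡-Reasoning
    exclusive : (at w j ≡ᵇ c) ≡ true → (at w j ≡ᵇ x) ≡ false
    exclusive e = ≢⇒≡ᵇ-false {at w j} (λ wj≡x → x≢c (trans (sym wj≡x) (≡ᵇ-true⇒≡ {at w j} e)))
    drop-not : ∀ a e₁ e₂ → (e₂ ≡ true → e₁ ≡ false) → (a ∧ not e₁) ∧ e₂ ≡ a ∧ e₂
    drop-not a e₁ false _ = trans (∧-zeroʳ _) (sym (∧-zeroʳ a))
    drop-not a e₁ true  h rewrite h refl = cong (_∧ true) (∧-identityʳ a)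

  block-cases : (P : ℕ → Set) → P x → (∀ {c} → x ≢ c → c < b → P c) → ∀ {c} → x ≡ c ⊎ c < b → P c
  block-cases P self other {c} c′ with x ≟ c | c′
  ... | yes refl | _        = self
  ... | no x≢c   | inj₁ x≡c = ⊥-elim (x≢c x≡c)
  ... | no x≢c   | inj₂ c<b = other x≢c c<b

  g<′ : ∀ {c} → x ≡ c ⊎ c < b → g (suc m) w′ c < suc m
  g<′ = block-cases (λ c → g (suc m) w′ c < suc m) g<-self g<-other

  at-g′ : ∀ {c} → x ≡ c ⊎ c < b → at w′ (g (suc m) w′ c) ≡ c
  at-g′ = block-cases (λ c → at w′ (g (suc m) w′ c) ≡ c) at-g-self at-g-other

  closer-at′ : ∀ {c} → x ≡ c ⊎ c < b → ∀ {j} → j < suc m →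
               (closer? (suc m) w′ j ∧ (at w′ j ≡ᵇ c)) ≡ (j ≡ᵇ g (suc m) w′ c)
  closer-at′ = block-cases
    (λ c → ∀ {j} → j < suc m → (closer? (suc m) w′ j ∧ (at w′ j ≡ᵇ c)) ≡ (j ≡ᵇ g (suc m) w′ c))
    closer-at-self closer-at-other

Blocks-old : ∀ {m b w} → Blocks m b w → ∀ {x} → x < b → Blocks (suc m) b (w ∷ʳ x)
Blocks-old {m} {b} {w} B {x} x<b = record
  { length≡   = length-w′
  ; letter<   = λ j<1+m → letter<′ (<-suc-cases j<1+m)
  ; Σ-openers = λ P → trans (Σ-openers-∷ʳ P)
                  (trans (cong (λ o → Σ< b (λ c → ⟦ P c ⟧) + ⟦ o ∧ P x ⟧) (occurs x<b)) (+-identityʳ _))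
  ; Σ-closers = λ P → trans (Σ-closers-∷ʳ P) (sym (trans (Σ<-extract b x (λ c → ⟦ P c ⟧) x<b)
                  (cong (_+ ⟦ P x ⟧) (Σ<-cong b (λ c _ → sym (⟦∧⟧ (not (c ≡ᵇ x)) (P c)))))))
  ; g<        = λ c<b → g<′ (inj₂ c<b)
  ; at-g      = λ c<b → at-g′ (inj₂ c<b)
  ; closer-at = λ c<b → closer-at′ (inj₂ c<b)
  }
  where
  open Blocks B
  open BlocksSnoc B x
  letter<′ : ∀ {j} → j < m ⊎ j ≡ m → at w′ j < b
  letter<′ (inj₁ j<m)  = subst (_< b) (sym (at-init j<m)) (letter< j<m)
  letter<′ (inj₂ refl) = subst (_< b) (sym at-last) x<b

Blocks-new : ∀ {m b w} → Blocks m b w → Blocks (suc m) (suc b) (w ∷ʳ b)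
Blocks-new {m} {b} {w} B = record
  { length≡   = length-w′
  ; letter<   = λ j<1+m → letter<′ (<-suc-cases j<1+m)
  ; Σ-openers = λ P → trans (Σ-openers-∷ʳ P) (cong (λ o → Σ< b (λ c → ⟦ P c ⟧) + ⟦ o ∧ P b ⟧) absent)
  ; Σ-closers = λ P → trans (Σ-closers-∷ʳ P) (cong (_+ ⟦ P b ⟧)
                  (Σ<-cong b (λ c c<b → cong (λ t → ⟦ not t ∧ P c ⟧) (≢⇒≡ᵇ-false (<⇒≢ c<b)))))
  ; g<        = λ c<1+b → g<′ (block′ (<-suc-cases c<1+b))
  ; at-g      = λ c<1+b → at-g′ (block′ (<-suc-cases c<1+b))
  ; closer-at = λ c<1+b → closer-at′ (block′ (<-suc-cases c<1+b))
  }
  where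
  open Blocks B
  open BlocksSnoc B b
  letter<′ : ∀ {j} → j < m ⊎ j ≡ m → at w′ j < suc b
  letter<′ (inj₁ j<m)  = subst (_< suc b) (sym (at-init j<m)) (m<n⇒m<1+n (letter< j<m))
  letter<′ (inj₂ refl) = subst (_< suc b) (sym at-last) ≤-refl
  absent : allBelow (λ j → not (at w j ≡ᵇ b)) m ≡ true
  absent = allBelow-true m (λ j j<m → cong not (≢⇒≡ᵇ-false (<⇒≢ (letter< j<m))))
  block′ : ∀ {c} → c < b ⊎ c ≡ b → b ≡ c ⊎ c < b
  block′ (inj₁ c<b)  = inj₂ c<b
  block′ (inj₂ refl) = inj₁ refl

rgfStep : ℕ → ℕ → Maybe ℕ
rgfStep x nb = if x <ᵇ nb then just nb else if x ≡ᵇ nb then just (suc nb) else nothing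

rgfBlocks-∷ʳ : ∀ w x nb → rgfBlocks (w ∷ʳ x) nb ≡ (rgfBlocks w nb >>= rgfStep x)
rgfBlocks-∷ʳ []      x nb = refl
rgfBlocks-∷ʳ (y ∷ w) x nb with y <ᵇ nb
... | true = rgfBlocks-∷ʳ w x nb
... | false with y ≡ᵇ nb
...   | true  = rgfBlocks-∷ʳ w x (suc nb)
...   | false = refl

hasBlocks≡ : ∀ b w → hasBlocks b w ≡ maybe′ (_≡ᵇ b) false (rgfBlocks w 0)
hasBlocks≡ b w with rgfBlocks w 0
... | just nb = refl
... | nothing = refl

Blocks-rgf : ∀ {w} → Reverse w → ∀ {b} → rgfBlocks w 0 ≡ just b → Blocks (length w) b w
Blocks-rgf [] refl = Blocks-[]
Blocks-rgf (w ∶ rw ∶ʳ x) {b} eq rewrite rgfBlocks-∷ʳ w x 0 with rgfBlocks w 0 in e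
... | just nb with x <ᵇ nb in x<nb
...   | true  rewrite sym (just-injective eq) =
      subst (λ n → Blocks n nb (w ∷ʳ x)) (sym (Snoc.length-w′ w x refl)) (Blocks-old (Blocks-rgf rw e) (<ᵇ-true⇒< x<nb))
...   | false with x ≡ᵇ nb in x≡nb
...     | true rewrite sym (just-injective eq) =
        subst₂ (λ n y → Blocks n (suc nb) (w ∷ʳ y)) (sym (Snoc.length-w′ w x refl)) (sym (≡ᵇ-true⇒≡ x≡nb))
               (Blocks-new (Blocks-rgf rw e))

Blocks-hasBlocks : ∀ {m b} w → length w ≡ m → hasBlocks b w ≡ true → Blocks m b w
Blocks-hasBlocks {m} {b} w refl hb = Blocks-rgf (reverseView w) (rgf≡ (trans (sym (hasBlocks≡ b w)) hb))
  where
  rgf≡ : maybe′ (_≡ᵇ b) false (rgfBlocks w 0) ≡ true → rgfBlocks w 0 ≡ just b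
  rgf≡ h with rgfBlocks w 0
  ... | just nb = cong just (≡ᵇ-true⇒≡ h)

hasBlocks-0-∷ʳ : ∀ w x → hasBlocks 0 (w ∷ʳ x) ≡ false
hasBlocks-0-∷ʳ w x rewrite hasBlocks≡ 0 (w ∷ʳ x) | rgfBlocks-∷ʳ w x 0 with rgfBlocks w 0
... | nothing = refl
... | just nb with x <ᵇ nb in x<nb
...   | true  = ≢⇒≡ᵇ-false (m<n⇒n≢0 (<ᵇ-true⇒< {x} {nb} x<nb))
...   | false with x ≡ᵇ nb
...     | true  = refl
...     | false = refl

rgfStep-hasBlocks : ∀ b x nb → ⟦ maybe′ (_≡ᵇ suc b) false (rgfStep x nb) ⟧
                       ≡ ⟦ nb ≡ᵇ suc b ⟧ * ⟦ x <ᵇ suc b ⟧ + ⟦ nb ≡ᵇ b ⟧ * ⟦ x ≡ᵇ b ⟧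
rgfStep-hasBlocks b x nb with <-cmp x nb
rgfStep-hasBlocks b x nb | tri< x<nb _ _ rewrite <⇒<ᵇ-true x<nb with nb ≟ suc b
... | yes refl rewrite ≡ᵇ-refl b | <⇒<ᵇ-true x<nb | ≢⇒≡ᵇ-false (1+n≢n {b}) = refl
... | no nb≢1+b with nb ≟ b
...   | yes refl rewrite ≢⇒≡ᵇ-false (<⇒≢ x<nb) | ≢⇒≡ᵇ-false nb≢1+b | ≡ᵇ-refl b = refl
...   | no nb≢b  rewrite ≢⇒≡ᵇ-false nb≢1+b | ≢⇒≡ᵇ-false nb≢b = refl
rgfStep-hasBlocks b x nb | tri≈ _ refl _ rewrite ≥⇒<ᵇ-false {x} ≤-refl | ≡ᵇ-refl x with x ≟ b
... | yes refl rewrite ≡ᵇ-refl x | ≢⇒≡ᵇ-false {x} (≢-sym 1+n≢n) = refl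
... | no x≢b rewrite ≢⇒≡ᵇ-false x≢b with x ≟ suc b
...   | yes refl rewrite ≡ᵇ-refl b | ≥⇒<ᵇ-false {suc b} ≤-refl = refl
...   | no x≢1+b rewrite ≢⇒≡ᵇ-false x≢1+b = refl
rgfStep-hasBlocks b x nb | tri> _ _ x>nb rewrite ≥⇒<ᵇ-false (<⇒≤ x>nb) | ≢⇒≡ᵇ-false (>⇒≢ x>nb) with nb ≟ suc b
... | yes refl rewrite ≥⇒<ᵇ-false (<⇒≤ x>nb) | ≡ᵇ-refl b | ≢⇒≡ᵇ-false (1+n≢n {b}) = refl
... | no nb≢1+b rewrite ≢⇒≡ᵇ-false nb≢1+b with nb ≟ b
...   | yes refl rewrite ≢⇒≡ᵇ-false (>⇒≢ x>nb) = sym (*-zeroʳ ⟦ nb ≡ᵇ nb ⟧)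
...   | no nb≢b  rewrite ≢⇒≡ᵇ-false nb≢b = refl

hasBlocks-∷ʳ : ∀ b w x → ⟦ hasBlocks (suc b) (w ∷ʳ x) ⟧
                       ≡ ⟦ hasBlocks (suc b) w ⟧ * ⟦ x <ᵇ suc b ⟧ + ⟦ hasBlocks b w ⟧ * ⟦ x ≡ᵇ b ⟧
hasBlocks-∷ʳ b w x
  rewrite hasBlocks≡ (suc b) (w ∷ʳ x) | hasBlocks≡ (suc b) w | hasBlocks≡ b w | rgfBlocks-∷ʳ w x 0
  with rgfBlocks w 0
... | nothing = refl
... | just nb = rgfStep-hasBlocks b x nb

Σ<-pairs-suc : ∀ m (Q : ℕ → ℕ → Bool) →
  Σ< (suc m) (λ i → Σ< (suc m) (λ j → ⟦ (j <ᵇ i) ∧ Q i j ⟧))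
  ≡ Σ< m (λ i → Σ< m (λ j → ⟦ (j <ᵇ i) ∧ Q i j ⟧)) + Σ< m (λ j → ⟦ Q m j ⟧)
Σ<-pairs-suc m Q = cong₂ _+_
  (Σ<-cong m (λ i i<m → trans (cong (λ t → Σ< m (λ j → ⟦ (j <ᵇ i) ∧ Q i j ⟧) + ⟦ t ∧ Q i m ⟧) (≥⇒<ᵇ-false (<⇒≤ i<m)))
                              (+-identityʳ _)))
  (trans (cong₂ _+_ (Σ<-cong m (λ j j<m → cong (λ t → ⟦ t ∧ Q m j ⟧) (<⇒<ᵇ-true j<m)))
                    (cong (λ t → ⟦ t ∧ Q m m ⟧) (≥⇒<ᵇ-false {m} ≤-refl)))
         (+-identityʳ _))

module MakSnoc {m b w} (B : Blocks m b w) (x : ℕ) where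
  open Blocks B
  open BlocksSnoc B x public

  closerPairs : (ℕ → Bool) → ℕ
  closerPairs C = Σ< m (λ i → Σ< m (λ j → ⟦ (j <ᵇ i) ∧ (closer? m w j ∧ C (at w j)) ∧ (at w j <ᵇ at w i) ⟧))

  mak𝒪-∷ʳ : mak𝒪 (suc m) w′ ≡ mak𝒪 m w + Σ< b (λ c → ⟦ x <ᵇ c ⟧)
  mak𝒪-∷ʳ = trans (Σ<-pairs-suc m _) (cong₂ _+_
    (Σ<-cong m (λ i i<m → Σ<-cong m (λ j j<m → cong₂ (λ o l → ⟦ (j <ᵇ i) ∧ o ∧ l ⟧)
       (opener?-init j<m) (cong₂ _<ᵇ_ (at-init i<m) (at-init j<m)))))
    (trans (Σ<-cong m (λ j j<m → cong₂ (λ o l → ⟦ o ∧ l ⟧) (opener?-init j<m) (cong₂ _<ᵇ_ at-last (at-init j<m))))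
           (Σ-openers (x <ᵇ_))))

  makℱ-∷ʳ : makℱ (suc m) w′ ≡ closerPairs (λ a → not (a ≡ᵇ x)) + Σ< b (λ c → ⟦ c <ᵇ x ⟧)
  makℱ-∷ʳ = trans (Σ<-pairs-suc m _) (cong₂ _+_
    (Σ<-cong m (λ i i<m → Σ<-cong m (λ j j<m → cong₂ (λ c l → ⟦ (j <ᵇ i) ∧ c ∧ l ⟧)
       (closer?-init j<m) (cong₂ _<ᵇ_ (at-init j<m) (at-init i<m)))))
    (trans (Σ<-cong m (λ j j<m → trans (cong₂ (λ c l → ⟦ c ∧ l ⟧) (closer?-init j<m) (cong₂ _<ᵇ_ (at-init j<m) at-last))
                                       (cong ⟦_⟧ (∧-assoc (closer? m w j) _ _))))
           (trans (Σ-closers (λ c → not (c ≡ᵇ x) ∧ (c <ᵇ x))) (Σ<-cong b (λ c _ → cong ⟦_⟧ (below c))))))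
    where
    below : ∀ c → not (c ≡ᵇ x) ∧ (c <ᵇ x) ≡ (c <ᵇ x)
    below c with c ≟ x
    ... | yes refl = trans (cong (λ t → not t ∧ (c <ᵇ c)) (≡ᵇ-refl c)) (sym (≥⇒<ᵇ-false {c} ≤-refl))
    ... | no c≢x   = cong (λ t → not t ∧ (c <ᵇ x)) (≢⇒≡ᵇ-false c≢x)

  makℱ-split : makℱ m w ≡ closerPairs (λ a → not (a ≡ᵇ x)) + closerPairs (_≡ᵇ x)
  makℱ-split = trans
    (Σ<-cong m (λ i _ → trans (Σ<-cong m (λ j _ → split (j <ᵇ i) (closer? m w j) (at w j ≡ᵇ x) (at w j <ᵇ at w i)))
                              (Σ<-distrib-+ m _ _)))
    (Σ<-distrib-+ m _ _)
    where
    split : ∀ a c e l → ⟦ a ∧ c ∧ l ⟧ ≡ ⟦ a ∧ (c ∧ not e) ∧ l ⟧ + ⟦ a ∧ (c ∧ e) ∧ l ⟧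
    split a c true  l rewrite ∧-zeroʳ c | ∧-identityʳ c | ∧-zeroʳ a = refl
    split a c false l rewrite ∧-zeroʳ c | ∧-identityʳ c | ∧-zeroʳ a = sym (+-identityʳ _)

  -- The new last letter adds inversions with the openers above it and the closers below it;
  -- the closer of block x stops being a closer, which removes its pairs.
  mak-∷ʳ : mak (suc m) w′ + closerPairs (_≡ᵇ x) ≡ mak m w + Σ< b (λ c → ⟦ not (c ≡ᵇ x) ⟧)
  mak-∷ʳ = begin
    mak (suc m) w′ + lost                        ≡⟨ cong (_+ lost) (mak≡mak𝒪+makℱ (suc m) w′) ⟩
    mak𝒪 (suc m) w′ + makℱ (suc m) w′ + lost     ≡⟨ cong₂ (λ o f → o + f + lost) mak𝒪-∷ʳ makℱ-∷ʳ ⟩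
    mak𝒪 m w + above + (kept + below) + lost      ≡⟨ regroup (mak𝒪 m w) above kept below lost ⟩
    mak𝒪 m w + (kept + lost) + (above + below)    ≡⟨ cong₂ (λ f a → mak𝒪 m w + f + a) makℱ-split (Σ<-distrib-+ b _ _) ⟨
    mak𝒪 m w + makℱ m w + Σ< b (λ c → ⟦ x <ᵇ c ⟧ + ⟦ c <ᵇ x ⟧)
      ≡⟨ cong₂ _+_ (mak≡mak𝒪+makℱ m w) (Σ<-cong b (λ c _ → sym (trichotomy c))) ⟨
    mak m w + Σ< b (λ c → ⟦ not (c ≡ᵇ x) ⟧)      ∎
    where
    open ≡-Reasoning
    lost kept above below : ℕ
    lost  = closerPairs (_≡ᵇ x)
    kept  = closerPairs (λ a → not (a ≡ᵇ x))
    above = Σ< b (λ c → ⟦ x <ᵇ c ⟧)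
    below = Σ< b (λ c → ⟦ c <ᵇ x ⟧)
    regroup : ∀ o a k l d → o + a + (k + l) + d ≡ o + (k + d) + (a + l)
    regroup = solve-∀
    trichotomy : ∀ c → ⟦ x <ᵇ c ⟧ + ⟦ c <ᵇ x ⟧ ≡ ⟦ not (c ≡ᵇ x) ⟧
    trichotomy c with <-cmp c x
    ... | tri< c<x _ _ rewrite ≥⇒<ᵇ-false (<⇒≤ c<x) | <⇒<ᵇ-true c<x | ≢⇒≡ᵇ-false (<⇒≢ c<x) = refl
    ... | tri≈ _ refl _ rewrite ≥⇒<ᵇ-false {c} ≤-refl | ≡ᵇ-refl c = refl
    ... | tri> _ _ c>x rewrite ≥⇒<ᵇ-false (<⇒≤ c>x) | <⇒<ᵇ-true c>x | ≢⇒≡ᵇ-false (>⇒≢ c>x) = refl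

  closerPairs-old : x < b → closerPairs (_≡ᵇ x) ≡ nrinv m w (g m w x)
  closerPairs-old x<b = trans
    (Σ<-cong m (λ i _ → trans
      (Σ<-cong m (λ j j<m → trans (cong (λ t → ⟦ (j <ᵇ i) ∧ t ∧ (at w j <ᵇ at w i) ⟧) (closer-at x<b j<m))
                                  (only-g i j)))
      (Σ<-≡ᵇ m (g m w x) _ (g< x<b))))
    (sym (count≡Σ< _ m))
    where
    only-g : ∀ i j → ⟦ (j <ᵇ i) ∧ (j ≡ᵇ g m w x) ∧ (at w j <ᵇ at w i) ⟧
                     ≡ ⟦ j ≡ᵇ g m w x ⟧ * ⟦ (g m w x <ᵇ i) ∧ (at w (g m w x) <ᵇ at w i) ⟧
    only-g i j with j ≟ g m w x
    ... | yes refl rewrite ≡ᵇ-refl j = sym (+-identityʳ _)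
    ... | no j≢g   rewrite ≢⇒≡ᵇ-false j≢g | ∧-zeroʳ (j <ᵇ i) = refl

  closerPairs-new : x ≡ b → closerPairs (_≡ᵇ x) ≡ 0
  closerPairs-new refl = Σ<-0 m (λ i _ → Σ<-0 m (λ j j<m →
    cong ⟦_⟧ (trans (cong (λ t → (j <ᵇ i) ∧ t ∧ (at w j <ᵇ at w i))
                          (trans (cong (closer? m w j ∧_) (≢⇒≡ᵇ-false (<⇒≢ (letter< j<m)))) (∧-zeroʳ _)))
                    (∧-zeroʳ (j <ᵇ i)))))

  nrinv-g-other : ∀ {c} → c < b → x ≢ c → nrinv (suc m) w′ (g (suc m) w′ c) ≡ nrinv m w (g m w c) + ⟦ c <ᵇ x ⟧
  nrinv-g-other {c} c<b x≢c = begin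
    nrinv (suc m) w′ (g (suc m) w′ c)               ≡⟨ cong (nrinv (suc m) w′) (g-other x≢c) ⟩
    nrinv (suc m) w′ (g m w c)                      ≡⟨ nrinv-init (g< c<b) ⟩
    nrinv m w (g m w c) + ⟦ at w (g m w c) <ᵇ x ⟧  ≡⟨ cong (λ a → nrinv m w (g m w c) + ⟦ a <ᵇ x ⟧) (at-g c<b) ⟩
    nrinv m w (g m w c) + ⟦ c <ᵇ x ⟧                ∎
    where open ≡-Reasoning

  nrinv-g-self : nrinv (suc m) w′ (g (suc m) w′ x) ≡ 0
  nrinv-g-self = trans (cong (nrinv (suc m) w′) g-self) (nrinv-last m w′)

Σ<-≢ : ∀ {k x} → x < suc k → Σ< (suc k) (λ c → ⟦ not (c ≡ᵇ x) ⟧) ≡ k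
Σ<-≢ {k} {x} x<1+k = +-cancelʳ-≡ 1 _ k (begin
  Σ< (suc k) (λ c → ⟦ not (c ≡ᵇ x) ⟧) + 1       ≡⟨ cong (_+ 1) (Σ<-cong (suc k) (λ c _ → *-identityʳ _)) ⟨
  Σ< (suc k) (λ c → ⟦ not (c ≡ᵇ x) ⟧ * 1) + 1   ≡⟨ Σ<-extract (suc k) x (λ _ → 1) x<1+k ⟨
  Σ< (suc k) (λ _ → 1)                          ≡⟨ Σ<-1 (suc k) ⟩
  suc k                                         ≡⟨ +-comm 1 k ⟩
  k + 1                                         ∎)
  where open ≡-Reasoning

mak-old : ∀ {m k w} → Blocks m (suc k) w → ∀ {x} → x < suc k →
          mak (suc m) (w ∷ʳ x) + nrinv m w (g m w x) ≡ mak m w + k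
mak-old B {x} x<1+k = trans (cong (_+_ _) (sym (closerPairs-old x<1+k))) (trans mak-∷ʳ (cong (_+_ _) (Σ<-≢ x<1+k)))
  where open MakSnoc B x

mak-new : ∀ {m k w} → Blocks m k w → mak (suc m) (w ∷ʳ k) ≡ mak m w + k
mak-new {m} {k} {w} B = begin
  mak (suc m) (w ∷ʳ k)                          ≡⟨ +-identityʳ _ ⟨
  mak (suc m) (w ∷ʳ k) + 0                      ≡⟨ cong (_+_ _) (closerPairs-new refl) ⟨
  mak (suc m) (w ∷ʳ k) + closerPairs (_≡ᵇ k)    ≡⟨ mak-∷ʳ ⟩
  mak m w + Σ< k (λ c → ⟦ not (c ≡ᵇ k) ⟧)       ≡⟨ cong (_+_ (mak m w)) (trans (Σ<-cong k others) (Σ<-1 k)) ⟩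
  mak m w + k                                   ∎
  where
  open ≡-Reasoning
  open MakSnoc B k
  others : ∀ c → c < k → ⟦ not (c ≡ᵇ k) ⟧ ≡ 1
  others c c<k = cong (λ t → ⟦ not t ⟧) (≢⇒≡ᵇ-false (<⇒≢ c<k))

mark : ℕ → (ℕ → Bool) → ℕ → Bool
mark x S c = S c ∨ (c ≡ᵇ x)

unmarked : ℕ → Bool
unmarked _ = false

Σ<-mark : ∀ b x (S : ℕ → Bool) (f : ℕ → ℕ) → x < b →
          Σ< b (λ c → ⟦ mark x S c ⟧ * f c) ≡ Σ< b (λ c → ⟦ not (c ≡ᵇ x) ⟧ * (⟦ S c ⟧ * f c)) + f x
Σ<-mark b x S f x<b = trans (Σ<-extract b x _ x<b) (cong₂ _+_
  (Σ<-cong b (λ c _ → unmark (S c) (c ≡ᵇ x) (f c)))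
  (trans (cong (λ t → ⟦ S x ∨ t ⟧ * f x) (≡ᵇ-refl x))
         (trans (cong (λ t → ⟦ t ⟧ * f x) (∨-zeroʳ (S x))) (+-identityʳ _))))
  where
  unmark : ∀ s e a → ⟦ not e ⟧ * (⟦ s ∨ e ⟧ * a) ≡ ⟦ not e ⟧ * (⟦ s ⟧ * a)
  unmark s true  a = refl
  unmark s false a = cong (λ t → 1 * (⟦ t ⟧ * a)) (∨-identityʳ s)

nrinvSum : ℕ → ℕ → (ℕ → Bool) → List ℕ → ℕ
nrinvSum m b S w = Σ< b (λ c → ⟦ S c ⟧ * nrinv m w (g m w c))

nrinvSum-old : ∀ {m b w} (S : ℕ → Bool) → Blocks m b w → ∀ {x} → x < b →
               nrinvSum (suc m) b S (w ∷ʳ x) + nrinv m w (g m w x) ≡ nrinvSum m b (mark x S) w + rank S x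
nrinvSum-old {m} {b} {w} S B {x} x<b = begin
  nrinvSum (suc m) b S w′ + r x           ≡⟨ cong (_+ r x) appended ⟩
  others + rank S x + r x                 ≡⟨ +-right-comm others (rank S x) (r x) ⟩
  others + r x + rank S x                 ≡⟨ cong (_+ rank S x) (Σ<-mark b x S r x<b) ⟨
  nrinvSum m b (mark x S) w + rank S x    ∎
  where
  open ≡-Reasoning
  open MakSnoc B x
  r : ℕ → ℕ
  r c = nrinv m w (g m w c)
  others : ℕ
  others = Σ< b (λ c → ⟦ not (c ≡ᵇ x) ⟧ * (⟦ S c ⟧ * r c))
  step : ∀ c → c < b → ⟦ not (c ≡ᵇ x) ⟧ * (⟦ S c ⟧ * nrinv (suc m) w′ (g (suc m) w′ c))
                      ≡ ⟦ not (c ≡ᵇ x) ⟧ * (⟦ S c ⟧ * r c) + ⟦ c <ᵇ x ⟧ * ⟦ S c ⟧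
  step c c<b with c ≟ x
  ... | yes refl rewrite ≡ᵇ-refl c | ≥⇒<ᵇ-false {c} ≤-refl = refl
  ... | no c≢x   rewrite ≢⇒≡ᵇ-false c≢x | nrinv-g-other c<b (≢-sym c≢x) = distrib ⟦ S c ⟧ (r c) ⟦ c <ᵇ x ⟧
    where
    distrib : ∀ s q l → 1 * (s * (q + l)) ≡ 1 * (s * q) + l * s
    distrib = solve-∀
  appended : nrinvSum (suc m) b S w′ ≡ others + rank S x
  appended = begin
    nrinvSum (suc m) b S w′
      ≡⟨ Σ<-extract b x _ x<b ⟩
    Σ< b (λ c → ⟦ not (c ≡ᵇ x) ⟧ * (⟦ S c ⟧ * nrinv (suc m) w′ (g (suc m) w′ c)))
      + ⟦ S x ⟧ * nrinv (suc m) w′ (g (suc m) w′ x)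
      ≡⟨ cong₂ _+_ (Σ<-cong b step) (trans (cong (⟦ S x ⟧ *_) nrinv-g-self) (*-zeroʳ ⟦ S x ⟧)) ⟩
    Σ< b (λ c → ⟦ not (c ≡ᵇ x) ⟧ * (⟦ S c ⟧ * r c) + ⟦ c <ᵇ x ⟧ * ⟦ S c ⟧) + 0
      ≡⟨ trans (+-identityʳ _) (Σ<-distrib-+ b _ _) ⟩
    others + Σ< b (λ c → ⟦ c <ᵇ x ⟧ * ⟦ S c ⟧)
      ≡⟨ cong (_+_ others) (Σ<-<ᵇ b x (λ c → ⟦ S c ⟧) (<⇒≤ x<b)) ⟩
    others + rank S x ∎

nrinvSum-new : ∀ {m k w} (S : ℕ → Bool) → Blocks m k w → nrinvSum (suc m) (suc k) S (w ∷ʳ k) ≡ nrinvSum m k S w + rank S k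
nrinvSum-new {m} {k} {w} S B = trans (cong₂ _+_ (Σ<-cong k step) (trans (cong (⟦ S k ⟧ *_) nrinv-g-self) (*-zeroʳ ⟦ S k ⟧)))
                                     (trans (+-identityʳ _) (Σ<-distrib-+ k _ _))
  where
  open MakSnoc B k
  step : ∀ c → c < k → ⟦ S c ⟧ * nrinv (suc m) w′ (g (suc m) w′ c) ≡ ⟦ S c ⟧ * nrinv m w (g m w c) + ⟦ S c ⟧
  step c c<k = begin
    ⟦ S c ⟧ * nrinv (suc m) w′ (g (suc m) w′ c)     ≡⟨ cong (⟦ S c ⟧ *_) (nrinv-g-other c<k (>⇒≢ c<k)) ⟩
    ⟦ S c ⟧ * (nrinv m w (g m w c) + ⟦ c <ᵇ k ⟧)    ≡⟨ cong (λ t → ⟦ S c ⟧ * (nrinv m w (g m w c) + ⟦ t ⟧)) (<⇒<ᵇ-true c<k) ⟩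
    ⟦ S c ⟧ * (nrinv m w (g m w c) + 1)             ≡⟨ *-distribˡ-+ ⟦ S c ⟧ _ 1 ⟩
    ⟦ S c ⟧ * nrinv m w (g m w c) + ⟦ S c ⟧ * 1     ≡⟨ cong (_+_ (⟦ S c ⟧ * nrinv m w (g m w c))) (*-identityʳ _) ⟩
    ⟦ S c ⟧ * nrinv m w (g m w c) + ⟦ S c ⟧         ∎
    where open ≡-Reasoning

markedMak : ℕ → ℕ → (ℕ → Bool) → List ℕ → ℤ
markedMak m b S w = + mak m w ℤ.- + nrinvSum m b S w

difference-shift : ∀ {a′ R′ r a R k ρ} → a′ + r ≡ a + k → R′ + r ≡ R + ρ →
                   + a′ ℤ.- + R′ ≡ (+ a ℤ.- + R) ℤ.+ (+ k ℤ.- + ρ)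
difference-shift {a′} {R′} {r} {a} {R} {k} {ρ} e e′ = begin
  + a′ ℤ.- + R′                          ≡⟨ add-both (+ a′) (+ R′) (+ r) ⟩
  (+ a′ ℤ.+ + r) ℤ.- (+ R′ ℤ.+ + r)      ≡⟨ cong₂ ℤ._-_ (pos a′ r a k e) (pos R′ r R ρ e′) ⟩
  (+ a ℤ.+ + k) ℤ.- (+ R ℤ.+ + ρ)        ≡⟨ regroup (+ a) (+ k) (+ R) (+ ρ) ⟩
  (+ a ℤ.- + R) ℤ.+ (+ k ℤ.- + ρ)        ∎
  where
  open ≡-Reasoning
  pos : ∀ p q s t → p + q ≡ s + t → + p ℤ.+ + q ≡ + s ℤ.+ + t
  pos p q s t h = trans (sym (ℤ.pos-+ p q)) (trans (cong +_ h) (ℤ.pos-+ s t))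
  add-both : ∀ x y z → x ℤ.- y ≡ (x ℤ.+ z) ℤ.- (y ℤ.+ z)
  add-both = ℤ-solve-∀
  regroup : ∀ a k R ρ → (a ℤ.+ k) ℤ.- (R ℤ.+ ρ) ≡ (a ℤ.- R) ℤ.+ (k ℤ.- ρ)
  regroup = ℤ-solve-∀

markedMak-old : ∀ {m k w} (S : ℕ → Bool) → Blocks m (suc k) w → ∀ {x} → x < suc k →
  markedMak (suc m) (suc k) S (w ∷ʳ x) ≡ markedMak m (suc k) (mark x S) w ℤ.+ (+ k ℤ.- + rank S x)
markedMak-old {m} {k} {w} S B {x} x<1+k =
  difference-shift {R′ = nrinvSum (suc m) (suc k) S (w ∷ʳ x)} {R = nrinvSum m (suc k) (mark x S) w} {ρ = rank S x}
                   (mak-old B x<1+k) (nrinvSum-old S B x<1+k)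

markedMak-new : ∀ {m k w} (S : ℕ → Bool) → Blocks m k w →
  markedMak (suc m) (suc k) S (w ∷ʳ k) ≡ markedMak m k S w ℤ.+ (+ k ℤ.- + rank S k)
markedMak-new {m} {k} {w} S B =
  difference-shift {R′ = nrinvSum (suc m) (suc k) S (w ∷ʳ k)} {r = 0} {R = nrinvSum m k S w} {ρ = rank S k}
                   (trans (+-identityʳ _) (mak-new B)) (trans (+-identityʳ _) (nrinvSum-new S B))

offset : ℕ → (ℕ → Bool) → ℕ
offset b S = Σ< b (λ c → ⟦ S c ⟧ * (b ∸ suc c))

offset-mark : ∀ b x (S : ℕ → Bool) → x < b → offset b (mark x S) ≡ offset b S + ⟦ not (S x) ⟧ * (b ∸ suc x)
offset-mark b x S x<b = begin
  offset b (mark x S)                          ≡⟨ Σ<-mark b x S (λ c → b ∸ suc c) x<b ⟩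
  others + B                                   ≡⟨ cong (_+_ others) (split (S x)) ⟩
  others + (⟦ S x ⟧ * B + ⟦ not (S x) ⟧ * B)   ≡⟨ +-assoc others _ _ ⟨
  others + ⟦ S x ⟧ * B + ⟦ not (S x) ⟧ * B     ≡⟨ cong (_+ ⟦ not (S x) ⟧ * B) (Σ<-extract b x _ x<b) ⟨
  offset b S + ⟦ not (S x) ⟧ * B               ∎
  where
  open ≡-Reasoning
  B others : ℕ
  B = b ∸ suc x
  others = Σ< b (λ c → ⟦ not (c ≡ᵇ x) ⟧ * (⟦ S c ⟧ * (b ∸ suc c)))
  split : ∀ s → B ≡ ⟦ s ⟧ * B + ⟦ not s ⟧ * B
  split true  = sym (trans (+-identityʳ _) (+-identityʳ B))
  split false = sym (+-identityʳ B)

offset-suc : ∀ k (S : ℕ → Bool) → offset (suc k) S ≡ offset k S + rank S k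
offset-suc k S = begin
  offset (suc k) S                                  ≡⟨ cong₂ _+_ (Σ<-cong k step) last ⟩
  Σ< k (λ c → ⟦ S c ⟧ * (k ∸ suc c) + ⟦ S c ⟧) + 0  ≡⟨ +-identityʳ _ ⟩
  Σ< k (λ c → ⟦ S c ⟧ * (k ∸ suc c) + ⟦ S c ⟧)      ≡⟨ Σ<-distrib-+ k _ _ ⟩
  offset k S + rank S k                             ∎
  where
  open ≡-Reasoning
  step : ∀ c → c < k → ⟦ S c ⟧ * (suc k ∸ suc c) ≡ ⟦ S c ⟧ * (k ∸ suc c) + ⟦ S c ⟧
  step c c<k = begin
    ⟦ S c ⟧ * (k ∸ c)                     ≡⟨ cong (⟦ S c ⟧ *_) (trans (+-∸-assoc 1 c<k) (+-comm 1 _)) ⟩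
    ⟦ S c ⟧ * (k ∸ suc c + 1)             ≡⟨ *-distribˡ-+ ⟦ S c ⟧ _ 1 ⟩
    ⟦ S c ⟧ * (k ∸ suc c) + ⟦ S c ⟧ * 1   ≡⟨ cong (_+_ (⟦ S c ⟧ * (k ∸ suc c))) (*-identityʳ _) ⟩
    ⟦ S c ⟧ * (k ∸ suc c) + ⟦ S c ⟧       ∎
  last : ⟦ S k ⟧ * (suc k ∸ suc k) ≡ 0
  last = trans (cong (⟦ S k ⟧ *_) (n∸n≡0 k)) (*-zeroʳ ⟦ S k ⟧)

pos-∸ : ∀ {m n} → n ≤ m → + (m ∸ n) ≡ + m ℤ.- + n
pos-∸ {m} {n} n≤m = sym (trans (ℤ.m-n≡m⊖n m n) (ℤ.⊖-≥ n≤m))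

offset-shift-old : ∀ k x (S : ℕ → Bool) n → x < suc k →
  (n ℤ.- (+ k ℤ.- + rank S x)) ℤ.+ + offset (suc k) (mark x S) ≡ (n ℤ.+ + offset (suc k) S) ℤ.- + shuffle (suc k) S x
offset-shift-old k x S n x<1+k =
  trans (cong (λ o → n′ ℤ.+ + o) (offset-mark (suc k) x S x<1+k)) (by-mark (S x))
  where
  open ≡-Reasoning
  ρ D : ℕ
  ρ = rank S x
  D = offset (suc k) S
  n′ : ℤ
  n′ = n ℤ.- (+ k ℤ.- + ρ)
  by-mark : ∀ s → n′ ℤ.+ + (D + ⟦ not s ⟧ * (k ∸ x)) ≡ (n ℤ.+ + D) ℤ.- + (if s then k ∸ ρ else x ∸ ρ)
  by-mark true = begin
    n′ ℤ.+ + (D + 0)                  ≡⟨ cong (λ d → n′ ℤ.+ + d) (+-identityʳ D) ⟩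
    n′ ℤ.+ + D                        ≡⟨ regroup n (+ D) (+ k) (+ ρ) ⟩
    (n ℤ.+ + D) ℤ.- (+ k ℤ.- + ρ)     ≡⟨ cong (λ t → (n ℤ.+ + D) ℤ.- t) (pos-∸ (≤-trans (rank≤ S x) (≤-pred x<1+k))) ⟨
    (n ℤ.+ + D) ℤ.- + (k ∸ ρ)         ∎
    where
    regroup : ∀ n d k r → (n ℤ.- (k ℤ.- r)) ℤ.+ d ≡ (n ℤ.+ d) ℤ.- (k ℤ.- r)
    regroup = ℤ-solve-∀
  by-mark false = begin
    n′ ℤ.+ + (D + (k ∸ x + 0))            ≡⟨ cong (λ d → n′ ℤ.+ + (D + d)) (+-identityʳ (k ∸ x)) ⟩
    n′ ℤ.+ + (D + (k ∸ x))                ≡⟨ cong (ℤ._+_ n′) (trans (ℤ.pos-+ D (k ∸ x)) (cong (ℤ._+_ (+ D)) (pos-∸ (≤-pred x<1+k)))) ⟩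
    n′ ℤ.+ (+ D ℤ.+ (+ k ℤ.- + x))        ≡⟨ regroup n (+ D) (+ k) (+ x) (+ ρ) ⟩
    (n ℤ.+ + D) ℤ.- (+ x ℤ.- + ρ)         ≡⟨ cong (λ t → (n ℤ.+ + D) ℤ.- t) (pos-∸ (rank≤ S x)) ⟨
    (n ℤ.+ + D) ℤ.- + (x ∸ ρ)             ∎
    where
    regroup : ∀ n d k x r → (n ℤ.- (k ℤ.- r)) ℤ.+ (d ℤ.+ (k ℤ.- x)) ≡ (n ℤ.+ d) ℤ.- (x ℤ.- r)
    regroup = ℤ-solve-∀

offset-shift-new : ∀ k (S : ℕ → Bool) n →
  (n ℤ.- (+ k ℤ.- + rank S k)) ℤ.+ + offset k S ≡ (n ℤ.+ + offset (suc k) S) ℤ.- + k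
offset-shift-new k S n rewrite offset-suc k S | ℤ.pos-+ (offset k S) (rank S k) =
  regroup n (+ k) (+ rank S k) (+ offset k S)
  where
  regroup : ∀ n k r d → (n ℤ.- (k ℤ.- r)) ℤ.+ d ≡ (n ℤ.+ (d ℤ.+ r)) ℤ.- k
  regroup = ℤ-solve-∀

does-≟-shift : ∀ a d n → does ((a ℤ.+ d) ℤ.≟ n) ≡ does (a ℤ.≟ (n ℤ.- d))
does-≟-shift a d n with (a ℤ.+ d) ℤ.≟ n | a ℤ.≟ (n ℤ.- d)
... | yes _ | yes _ = refl
... | no  _ | no  _ = refl
... | yes p | no ¬q = ⊥-elim (¬q (trans (sym (cancelʳ a d)) (cong (ℤ._- d) p)))
  where
  cancelʳ : ∀ a d → a ℤ.+ d ℤ.- d ≡ a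
  cancelʳ = ℤ-solve-∀
... | no ¬p | yes q = ⊥-elim (¬p (trans (cong (ℤ._+ d) q) (cancelʳ n d)))
  where
  cancelʳ : ∀ n d → n ℤ.- d ℤ.+ d ≡ n
  cancelʳ = ℤ-solve-∀

Σ<-hasBlocks-∷ʳ : ∀ {N} k w (V : ℕ → ℕ) → suc k ≤ N →
  Σ< N (λ x → ⟦ hasBlocks (suc k) (w ∷ʳ x) ⟧ * V x) ≡ ⟦ hasBlocks (suc k) w ⟧ * Σ< (suc k) V + ⟦ hasBlocks k w ⟧ * V k
Σ<-hasBlocks-∷ʳ {N} k w V k<N = begin
  Σ< N (λ x → ⟦ hasBlocks (suc k) (w ∷ʳ x) ⟧ * V x)
    ≡⟨ Σ<-cong N (λ x _ → trans (cong (_* V x) (hasBlocks-∷ʳ k w x)) (distrib ⟦ B₊ ⟧ _ ⟦ B ⟧ _ (V x))) ⟩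
  Σ< N (λ x → ⟦ B₊ ⟧ * (⟦ x <ᵇ suc k ⟧ * V x) + ⟦ B ⟧ * (⟦ x ≡ᵇ k ⟧ * V x))
    ≡⟨ Σ<-distrib-+ N _ _ ⟩
  Σ< N (λ x → ⟦ B₊ ⟧ * (⟦ x <ᵇ suc k ⟧ * V x)) + Σ< N (λ x → ⟦ B ⟧ * (⟦ x ≡ᵇ k ⟧ * V x))
    ≡⟨ cong₂ _+_ (*-distribˡ-Σ< N ⟦ B₊ ⟧ _) (*-distribˡ-Σ< N ⟦ B ⟧ _) ⟩
  ⟦ B₊ ⟧ * Σ< N (λ x → ⟦ x <ᵇ suc k ⟧ * V x) + ⟦ B ⟧ * Σ< N (λ x → ⟦ x ≡ᵇ k ⟧ * V x)
    ≡⟨ cong₂ (λ p q → ⟦ B₊ ⟧ * p + ⟦ B ⟧ * q) (Σ<-<ᵇ N (suc k) V k<N) (Σ<-≡ᵇ N k V k<N) ⟩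
  ⟦ B₊ ⟧ * Σ< (suc k) V + ⟦ B ⟧ * V k ∎
  where
  open ≡-Reasoning
  B₊ B : Bool
  B₊ = hasBlocks (suc k) w
  B  = hasBlocks k w
  distrib : ∀ a p c q v → (a * p + c * q) * v ≡ a * (p * v) + c * (q * v)
  distrib = solve-∀

module Counting (N : ℕ) where

  Coeff : ℕ → ℕ → (List ℕ → ℤ) → ℤ → ℕ
  Coeff m b e n = Σ∈ (words m N) (λ w → ⟦ hasBlocks b w ⟧ * ⟦ does (e w ℤ.≟ n) ⟧)

  Coeff-shift : ∀ m b {e e′ : List ℕ → ℤ} d n →
                (∀ w → length w ≡ m → hasBlocks b w ≡ true → e w ≡ e′ w ℤ.+ d) →
                Coeff m b e n ≡ Coeff m b e′ (n ℤ.- d)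
  Coeff-shift m b {e} {e′} d n h = Σ∈-words-cong m N (λ w len → ⟦⟧*-cong (hasBlocks b w) (λ hb →
    cong ⟦_⟧ (trans (cong (λ t → does (t ℤ.≟ n)) (h w len hb)) (does-≟-shift (e′ w) d n))))

  Coeff-0 : ∀ m e n → Coeff (suc m) 0 e n ≡ 0
  Coeff-0 m e n = trans (Σ∈-words-∷ʳ m N _) (Σ∈-0 (words m N) (λ w →
    Σ<-0 N (λ x _ → cong (λ t → ⟦ t ⟧ * ⟦ does (e (w ∷ʳ x) ℤ.≟ n) ⟧) (hasBlocks-0-∷ʳ w x))))

  Coeff-∷ʳ : ∀ m k (e : List ℕ → ℤ) n → suc k ≤ N →
    Coeff (suc m) (suc k) e n ≡ Σ< (suc k) (λ x → Coeff m (suc k) (e ∘ (_∷ʳ x)) n) + Coeff m k (e ∘ (_∷ʳ k)) n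
  Coeff-∷ʳ m k e n k<N = begin
    Coeff (suc m) (suc k) e n
      ≡⟨ Σ∈-words-∷ʳ m N _ ⟩
    Σ∈ (words m N) (λ w → Σ< N (λ x → ⟦ hasBlocks (suc k) (w ∷ʳ x) ⟧ * V w x))
      ≡⟨ Σ∈-cong (words m N) (λ w → Σ<-hasBlocks-∷ʳ k w (V w) k<N) ⟩
    Σ∈ (words m N) (λ w → ⟦ hasBlocks (suc k) w ⟧ * Σ< (suc k) (V w) + ⟦ hasBlocks k w ⟧ * V w k)
      ≡⟨ Σ∈-distrib-+ (words m N) _ _ ⟩
    Σ∈ (words m N) (λ w → ⟦ hasBlocks (suc k) w ⟧ * Σ< (suc k) (V w)) + Coeff m k (e ∘ (_∷ʳ k)) n
      ≡⟨ cong (_+ Coeff m k (e ∘ (_∷ʳ k)) n)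
              (Σ∈-cong (words m N) (λ w → *-distribˡ-Σ< (suc k) ⟦ hasBlocks (suc k) w ⟧ (V w))) ⟨
    Σ∈ (words m N) (λ w → Σ< (suc k) (λ x → ⟦ hasBlocks (suc k) w ⟧ * V w x)) + Coeff m k (e ∘ (_∷ʳ k)) n
      ≡⟨ cong (_+ Coeff m k (e ∘ (_∷ʳ k)) n) (Σ∈-Σ<-comm (words m N) (suc k) _) ⟩
    Σ< (suc k) (λ x → Coeff m (suc k) (e ∘ (_∷ʳ x)) n) + Coeff m k (e ∘ (_∷ʳ k)) n ∎
    where
    open ≡-Reasoning
    V : List ℕ → ℕ → ℕ
    V w x = ⟦ does (e (w ∷ʳ x) ℤ.≟ n) ⟧

  Coeff-markedMak-∷ʳ : ∀ m k (S : ℕ → Bool) n → suc k ≤ N →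
    Coeff (suc m) (suc k) (markedMak (suc m) (suc k) S) n
    ≡ Σ< (suc k) (λ x → Coeff m (suc k) (markedMak m (suc k) (mark x S)) (n ℤ.- (+ k ℤ.- + rank S x)))
      + Coeff m k (markedMak m k S) (n ℤ.- (+ k ℤ.- + rank S k))
  Coeff-markedMak-∷ʳ m k S n k<N = trans (Coeff-∷ʳ m k (markedMak (suc m) (suc k) S) n k<N) (cong₂ _+_
    (Σ<-cong (suc k) (λ x x<1+k → Coeff-shift m (suc k) {e′ = markedMak m (suc k) (mark x S)} _ n
      (λ w len hb → markedMak-old S (Blocks-hasBlocks w len hb) x<1+k)))
    (Coeff-shift m k {e′ = markedMak m k S} _ n
      (λ w len hb → markedMak-new S (Blocks-hasBlocks w len hb))))

  makRecurrence : ℕ → ℕ → ℤ → ℕ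
  makRecurrence m zero    t = 0
  makRecurrence m (suc k) t = Σ< (suc k) (λ y → Coeff m (suc k) (markedMak m (suc k) unmarked) (t ℤ.- + y))
                              + Coeff m k (markedMak m k unmarked) (t ℤ.- + k)

  MarkedMakDistribution : ℕ → Set
  MarkedMakDistribution m = ∀ b → b ≤ N → ∀ (S : ℕ → Bool) n →
    Coeff m b (markedMak m b S) n ≡ Coeff m b (markedMak m b unmarked) (n ℤ.+ + offset b S)

  Coeff-markedMak-suc : ∀ m → MarkedMakDistribution m → ∀ b → b ≤ N → ∀ (S : ℕ → Bool) n →
    Coeff (suc m) b (markedMak (suc m) b S) n ≡ makRecurrence m b (n ℤ.+ + offset b S)
  Coeff-markedMak-suc m IH zero    _   S n = Coeff-0 m (markedMak (suc m) 0 S) n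
  Coeff-markedMak-suc m IH (suc k) k<N S n = begin
    Coeff (suc m) (suc k) (markedMak (suc m) (suc k) S) n
      ≡⟨ Coeff-markedMak-∷ʳ m k S n k<N ⟩
    Σ< (suc k) (λ x → Coeff m (suc k) (markedMak m (suc k) (mark x S)) (n ℤ.- δ x)) + Coeff m k (markedMak m k S) (n ℤ.- δ k)
      ≡⟨ cong₂ _+_ (Σ<-cong (suc k) (λ x x<1+k → trans (IH (suc k) k<N (mark x S) (n ℤ.- δ x))
                                                         (cong (Coeff m (suc k) E∅) (offset-shift-old k x S n x<1+k))))
                   (trans (IH k (<⇒≤ k<N) S (n ℤ.- δ k)) (cong (Coeff m k (markedMak m k unmarked)) (offset-shift-new k S n))) ⟩
    Σ< (suc k) (h ∘ shuffle (suc k) S) + Coeff m k (markedMak m k unmarked) (t ℤ.- + k)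
      ≡⟨ cong (_+ Coeff m k (markedMak m k unmarked) (t ℤ.- + k)) (Σ<-shuffle (suc k) S h) ⟩
    makRecurrence m (suc k) t ∎
    where
    open ≡-Reasoning
    E∅ : List ℕ → ℤ
    E∅ = markedMak m (suc k) unmarked
    δ : ℕ → ℤ
    δ x = + k ℤ.- + rank S x
    t : ℤ
    t = n ℤ.+ + offset (suc k) S
    h : ℕ → ℕ
    h y = Coeff m (suc k) E∅ (t ℤ.- + y)

  markedMak-distribution : ∀ m → MarkedMakDistribution m
  markedMak-distribution zero    zero    _ S n = cong (Coeff 0 0 (markedMak 0 0 unmarked)) (sym (ℤ.+-identityʳ n))
  markedMak-distribution zero    (suc b) _ S n = refl
  markedMak-distribution (suc m) b b≤N S n = begin
    Coeff (suc m) b (markedMak (suc m) b S) n         ≡⟨ Coeff-markedMak-suc m IH b b≤N S n ⟩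
    makRecurrence m b t                               ≡⟨ cong (makRecurrence m b) (sym (ℤ.+-identityʳ t)) ⟩
    makRecurrence m b (t ℤ.+ + 0)                     ≡⟨ cong (λ o → makRecurrence m b (t ℤ.+ + o)) (Σ<-0 b (λ _ _ → refl)) ⟨
    makRecurrence m b (t ℤ.+ + offset b unmarked)     ≡⟨ Coeff-markedMak-suc m IH b b≤N unmarked t ⟨
    Coeff (suc m) b (markedMak (suc m) b unmarked) t  ∎
    where
    open ≡-Reasoning
    IH : MarkedMakDistribution m
    IH = markedMak-distribution m
    t : ℤ
    t = n ℤ.+ + offset b S

coeff≡Coeff : ∀ m k e n → coeff m k e n ≡ Counting.Coeff (suc k) m (suc k) e n
coeff≡Coeff m k e n = begin
  length (filter P? (filter Q? W))              ≡⟨ length≡Σ∈1 (filter P? (filter Q? W)) ⟩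
  Σ∈ (filter P? (filter Q? W)) (λ _ → 1)        ≡⟨ Σ∈-filter P? (filter Q? W) _ ⟩
  Σ∈ (filter Q? W) (λ w → ⟦ does (P? w) ⟧ * 1)  ≡⟨ Σ∈-filter Q? W _ ⟩
  Σ∈ W (λ w → ⟦ does (Q? w) ⟧ * (⟦ does (P? w) ⟧ * 1))
    ≡⟨ Σ∈-cong W (λ w → cong₂ _*_ (cong ⟦_⟧ (does-≟-true (hasBlocks (suc k) w))) (*-identityʳ _)) ⟩
  Counting.Coeff (suc k) m (suc k) e n ∎
  where
  open ≡-Reasoning
  W : List (List ℕ)
  W = words m (suc k)
  P? : Decidable (λ w → e w ≡ n)
  P? w = e w ℤ.≟ n
  Q? : Decidable (λ w → hasBlocks (suc k) w ≡ true)
  Q? w = hasBlocks (suc k) w Bool.≟ true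
  does-≟-true : ∀ β → does (β Bool.≟ true) ≡ β
  does-≟-true true  = refl
  does-≟-true false = refl

lhsExp≡markedMak : ∀ m k i w → i ≤ k → lhsExp m k i w ≡ markedMak m (suc k) (_≡ᵇ i) w ℤ.+ + k
lhsExp≡markedMak m k i w i≤k = begin
  + (mak m w + k) ℤ.- + r                ≡⟨ cong (ℤ._- + r) (ℤ.pos-+ (mak m w) k) ⟩
  (+ mak m w ℤ.+ + k) ℤ.- + r            ≡⟨ swap (+ mak m w) (+ k) (+ r) ⟩
  (+ mak m w ℤ.- + r) ℤ.+ + k            ≡⟨ cong (λ t → (+ mak m w ℤ.- + t) ℤ.+ + k) (Σ<-≡ᵇ (suc k) i _ (s≤s i≤k)) ⟨
  markedMak m (suc k) (_≡ᵇ i) w ℤ.+ + k  ∎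
  where
  open ≡-Reasoning
  r : ℕ
  r = nrinv m w (g m w i)
  swap : ∀ a k r → a ℤ.+ k ℤ.- r ≡ a ℤ.- r ℤ.+ k
  swap = ℤ-solve-∀

rhsExp≡markedMak : ∀ m b i w → rhsExp m i w ≡ markedMak m b unmarked w ℤ.+ + i
rhsExp≡markedMak m b i w = begin
  + (mak m w + i)                   ≡⟨ ℤ.pos-+ (mak m w) i ⟩
  + mak m w ℤ.+ + i                 ≡⟨ cong (ℤ._+ + i) (ℤ.+-identityʳ (+ mak m w)) ⟨
  + mak m w ℤ.- + 0 ℤ.+ + i         ≡⟨ cong (λ t → + mak m w ℤ.- + t ℤ.+ + i) (Σ<-0 b (λ _ _ → refl)) ⟨
  markedMak m b unmarked w ℤ.+ + i  ∎
  where open ≡-Reasoning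

offset-≡ᵇ-shift : ∀ {k i} → i ≤ k → ∀ n → n ℤ.- + k ℤ.+ + offset (suc k) (_≡ᵇ i) ≡ n ℤ.- + i
offset-≡ᵇ-shift {k} {i} i≤k n = begin
  n ℤ.- + k ℤ.+ + offset (suc k) (_≡ᵇ i)  ≡⟨ cong (λ o → n ℤ.- + k ℤ.+ + o) (Σ<-≡ᵇ (suc k) i (λ c → suc k ∸ suc c) (s≤s i≤k)) ⟩
  n ℤ.- + k ℤ.+ + (k ∸ i)                 ≡⟨ cong (ℤ._+_ (n ℤ.- + k)) (pos-∸ i≤k) ⟩
  n ℤ.- + k ℤ.+ (+ k ℤ.- + i)             ≡⟨ cancel n (+ k) (+ i) ⟩
  n ℤ.- + i                               ∎
  where
  open ≡-Reasoning
  cancel : ∀ n k i → n ℤ.- k ℤ.+ (k ℤ.- i) ≡ n ℤ.- i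
  cancel = ℤ-solve-∀

mainTheorem7 : (m k : ℕ) → 1 ≤ m → 1 ≤ k → (i : ℕ) → 1 ≤ i → i ≤ k →
    (n : ℤ) → coeff m k (lhsExp m k i) n ≡ coeff m k (rhsExp m i) n
mainTheorem7 m k _ _ i _ i≤k n = begin
  coeff m k (lhsExp m k i) n
    ≡⟨ coeff≡Coeff m k _ n ⟩
  Coeff m (suc k) (lhsExp m k i) n
    ≡⟨ Coeff-shift m (suc k) {e′ = markedMak m (suc k) (_≡ᵇ i)} (+ k) n (λ w _ _ → lhsExp≡markedMak m k i w i≤k) ⟩
  Coeff m (suc k) (markedMak m (suc k) (_≡ᵇ i)) (n ℤ.- + k)
    ≡⟨ markedMak-distribution m (suc k) ≤-refl (_≡ᵇ i) _ ⟩
  Coeff m (suc k) mak∅ (n ℤ.- + k ℤ.+ + offset (suc k) (_≡ᵇ i))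
    ≡⟨ cong (Coeff m (suc k) mak∅) (offset-≡ᵇ-shift i≤k n) ⟩
  Coeff m (suc k) mak∅ (n ℤ.- + i)
    ≡⟨ Coeff-shift m (suc k) {e′ = mak∅} (+ i) n (λ w _ _ → rhsExp≡markedMak m (suc k) i w) ⟨
  Coeff m (suc k) (rhsExp m i) n
    ≡⟨ coeff≡Coeff m k _ n ⟨
  coeff m k (rhsExp m i) n ∎
  where
  open ≡-Reasoning
  open Counting (suc k)
  mak∅ : List ℕ → ℤ
  mak∅ = markedMak m (suc k) unmarked
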